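{- Let $\mathbf{R}$ be a commutative ring containing $\mathbb{Q}$. Let $\mathcal{Q}$ be the set of $5$-tuples $(g,f_1,f_2,f_3,f_4)$ with $g\in\mathbf{R}[[x^4]]$, $g_0=1$, and $f_i\in x\mathbf{R}[[x^4]]$ with $(f_i)_1=1$ for $i=1,\dots,4$. For such a tuple let $h=(f_1f_2f_3f_4)^{1/4}$ (the power series $x+\cdots$ whose fourth power is $f_1f_2f_3f_4$) and $\bar h$ its compositional inverse. With the product $$(g,f_1,f_2,f_3,f_4)\cdot(G,F_1,F_2,F_3,F_4)=\left(gG(h),\frac{f_1}{h}F_1(h),\frac{f_2}{h}F_2(h),\frac{f_3}{h}F_3(h),\frac{f_4}{h}F_4(h)\right),$$ $\mathcal{Q}$ is a group with identity $(1,x,x,x,x)$, and $$(g,f_1,f_2,f_3,f_4)^{ -1}=\left(\frac{1}{g(\bar h)},\frac{x\bar h}{f_1(\bar h)},\frac{x\bar h}{f_2(\bar h)},\frac{x\bar h}{f_3(\bar h)},\frac{x\bar h}{f_4(\bar h)}\right).$$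
   Context: $g_0$ is the constant coefficient of $g$ and $(f_i)_1$ the coefficient of $x$ in $f_i$. $\mathcal{Q}$ is called the quadruple Riordan group; the element $(g,f_1,f_2,f_3,f_4)$ is represented by the lower-triangular matrix with $(n,k)$ entry $[x^n]\,g f_1^{\lfloor (k+3)/4\rfloor}f_2^{\lfloor (k+2)/4\rfloor}f_3^{\lfloor (k+1)/4\rfloor}f_4^{\lfloor k/4\rfloor}$. -}

module Defs where

open import Level using (Level; _⊔_)
open import Data.Nat using (ℕ; zero; suc; _∸_; _%_) renaming (_+_ to _+ℕ_)
open import Data.Nat.Properties using (_≟_)
open import Data.Fin using (Fin)
open import Data.Product using (_×_)
open import Relation.Nullary using (¬_; yes; no)
open import Relation.Binary.PropositionalEquality using (_≡_)
open import Algebra.Bundles using (CommutativeRing)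
open import Algebra.Morphism.Structures using (module RingMorphisms)
import Data.Integer as ℤ
open import Data.Rational as ℚ using (ℚ)
open import Data.Rational.Properties using (+-*-commutativeRing)

record Containsℚ {c ℓ} (R : CommutativeRing c ℓ) : Set (c ⊔ ℓ) where
  open CommutativeRing R using (Carrier; _≈_; rawRing)
  open RingMorphisms (CommutativeRing.rawRing +-*-commutativeRing) rawRing
  field
    φ          : ℚ → Carrier
    isRingHom  : IsRingHomomorphism φ
    injective  : ∀ p q → φ p ≈ φ q → p ≡ q

record IsGroupOn {a p ℓ} {A : Set a} (P : A → Set p) (_≈_ : A → A → Set ℓ)
                 (_∙_ : A → A → A) (e : A) (inv : A → A) : Set (a ⊔ p ⊔ ℓ) where
  field
    ∙-closed   : ∀ {x y} → P x → P y → P (x ∙ y)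
    e-closed   : P e
    inv-closed : ∀ {x} → P x → P (inv x)
    ∙-cong     : ∀ {x x′ y y′} → P x → P x′ → P y → P y′ →
                 x ≈ x′ → y ≈ y′ → (x ∙ y) ≈ (x′ ∙ y′)
    inv-cong   : ∀ {x x′} → P x → P x′ → x ≈ x′ → inv x ≈ inv x′
    assoc      : ∀ {x y z} → P x → P y → P z → ((x ∙ y) ∙ z) ≈ (x ∙ (y ∙ z))
    identityˡ  : ∀ {x} → P x → (e ∙ x) ≈ x
    identityʳ  : ∀ {x} → P x → (x ∙ e) ≈ x
    inverseˡ   : ∀ {x} → P x → (inv x ∙ x) ≈ e
    inverseʳ   : ∀ {x} → P x → (x ∙ inv x) ≈ e

module QuadRiordan {c ℓ} (R : CommutativeRing c ℓ) (inc : Containsℚ R) where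
  open CommutativeRing R
  open Containsℚ inc using (φ)

  PS : Set c
  PS = ℕ → Carrier

  _≈ₛ_ : PS → PS → Set ℓ
  f ≈ₛ g = ∀ n → f n ≈ g n

  Σ< : ℕ → (ℕ → Carrier) → Carrier
  Σ< zero    f = 0#
  Σ< (suc n) f = Σ< n f + f n

  δ₀ : ℕ → Carrier
  δ₀ zero    = 1#
  δ₀ (suc _) = 0#

  one : PS
  one = δ₀

  X : PS
  X zero          = 0#
  X (suc zero)    = 1#
  X (suc (suc _)) = 0#

  mul : PS → PS → PS
  mul f g n = Σ< (suc n) (λ k → f k * g (n ∸ k))

  pow : PS → ℕ → PS
  pow f zero    = one
  pow f (suc k) = mul f (pow f k)

  -- composition g(h), for h with zero constant term
  comp : PS → PS → PS
  comp g h n = Σ< (suc n) (λ k → g k * pow h k n)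

  shift : PS → PS
  shift f n = f (suc n)

  -- sequences defined by strong recursion on the index:
  -- step n s computes the n-th term, using only s i for i < n.
  prefix : (ℕ → PS → Carrier) → ℕ → PS
  prefix step zero    i = 0#
  prefix step (suc n) i with i ≟ n
  ... | yes _ = step n (prefix step n)
  ... | no  _ = prefix step n i

  seqRec : (ℕ → PS → Carrier) → PS
  seqRec step n = step n (prefix step n)

  -- multiplicative inverse 1/g of a series g with g₀ = 1
  recip₁ : PS → PS
  recip₁ g = seqRec step
    where
    step : ℕ → PS → Carrier
    step zero    r = 1#
    step (suc n) r = - Σ< (suc n) (λ k → g (suc n ∸ k) * r k)

  -- f / k for f, k ∈ xR[[x]] with k₁ = 1, i.e. (f/x)·(k/x)⁻¹
  div : PS → PS → PS
  div f k = mul (shift f) (recip₁ (shift k))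

  quarter : Carrier
  quarter = φ (ℤ.+ 1 ℚ./ 4)

  -- fourth root: for p = x⁴ + ..., the series h = x + ... with h⁴ = p
  root4 : PS → PS
  root4 p zero    = 0#
  root4 p (suc n) = u n
    where
    q : PS
    q m = p (4 +ℕ m)
    step : ℕ → PS → Carrier
    step zero    v = 1#
    step (suc m) v = quarter * (q (suc m) - pow v 4 (suc m))
    u : PS
    u = seqRec step

  -- compositional inverse h̄ of h = x + ... (h(h̄) = x)
  compInv : PS → PS
  compInv h = seqRec step
    where
    step : ℕ → PS → Carrier
    step zero    s = 0#
    step (suc n) s = δ₀ n - Σ< n (λ j → h (2 +ℕ j) * pow s (2 +ℕ j) (suc n))

  -- 5-tuples (g, f₁, f₂, f₃, f₄); f i is f_{i+1}
  record Tuple : Set c where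
    constructor ⟨_,_⟩
    field
      g : PS
      f : Fin 4 → PS
  open Tuple public

  _≈Q_ : Tuple → Tuple → Set ℓ
  a ≈Q b = (g a ≈ₛ g b) × (∀ i → f a i ≈ₛ f b i)

  InRx4 : PS → Set ℓ
  InRx4 s = ∀ n → ¬ (n % 4 ≡ 0) → s n ≈ 0#

  InxRx4 : PS → Set ℓ
  InxRx4 s = ∀ n → ¬ (n % 4 ≡ 1) → s n ≈ 0#

  InQ : Tuple → Set ℓ
  InQ a = InRx4 (g a) × (g a 0 ≈ 1#) × (∀ i → InxRx4 (f a i) × (f a i 1 ≈ 1#))

  hOf : Tuple → PS
  hOf a = root4 (mul (f a Fin.zero) (mul (f a (Fin.suc Fin.zero))
            (mul (f a (Fin.suc (Fin.suc Fin.zero))) (f a (Fin.suc (Fin.suc (Fin.suc Fin.zero)))))))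

  _·Q_ : Tuple → Tuple → Tuple
  a ·Q b = ⟨ mul (g a) (comp (g b) (hOf a))
           , (λ i → mul (div (f a i) (hOf a)) (comp (f b i) (hOf a))) ⟩

  eQ : Tuple
  eQ = ⟨ one , (λ _ → X) ⟩

  invQ : Tuple → Tuple
  invQ a = ⟨ recip₁ (comp (g a) (compInv (hOf a)))
           , (λ i → div (mul X (compInv (hOf a))) (comp (f a i) (compInv (hOf a)))) ⟩

{-# OPTIONS --safe #-}
module Submission where

-- For a = (g, f₁, …, f₄) write h = (f₁f₂f₃f₄)^{1/4} and dᵢ = fᵢ/h. The product then reads
-- (g, d)·(G, F) = (g · G(h), dᵢ · Fᵢ(h)): both components have the form p · q(h), and such twisted
-- products are associative because composition with h is an associative ring homomorphism.
-- Everything else rests on h being the unique series x + ⋯ with h⁴ = f₁f₂f₃f₄: for u, v with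
-- constant term 1, u⁴ − v⁴ = (u − v)(u³ + u²v + uv² + v³), whose second factor has constant term 4,
-- a unit as ℚ ⊆ R. Hence d₁d₂d₃d₄ = 1, and the h-series of a·b, of (1, x, x, x, x) and of a⁻¹ are
-- H(h), x and h̄, so that the group laws become identities between power series. Closure holds
-- because all operations involved respect the grading of exponents modulo 4.

open import Algebra.Bundles using (CommutativeRing)
import Algebra.Properties.CommutativeMonoid.Sum as CommutativeMonoidSum
import Algebra.Properties.CommutativeSemigroup as CommutativeSemigroupProperties
import Algebra.Properties.Group as GroupProperties
import Algebra.Properties.Ring as RingProperties
import Algebra.Solver.Ring as RingSolver
open import Algebra.Solver.Ring.AlmostCommutativeRing
  using (fromCommutativeRing; _-Raw-AlmostCommutative⟶_)
import Algebra.Solver.Ring.NaturalCoefficients.Default as NaturalCoefficientsSolver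
open import Algebra.Structures using (IsCommutativeRing)
open import Algebra.Morphism.Structures using (module RingMorphisms)
open import Data.Empty using (⊥-elim)
open import Data.Fin using (Fin)
import Data.Integer as ℤ
open import Data.Maybe using (Maybe)
import Data.Maybe as Maybe
open import Data.Nat using (ℕ; zero; suc; _∸_; _%_; _≤_; _<_; z≤n; s≤s; _≤′_; ≤′-refl; ≤′-step)
  renaming (_+_ to _+ℕ_; _*_ to _*ℕ_)
open import Data.Nat.DivMod using (%-distribˡ-+; [m+n]%n≡m%n)
open import Data.Nat.Induction using (<-rec)
import Data.Nat.Properties as ℕ
open import Data.Product using (_,_; proj₁; proj₂)
open import Data.Rational as ℚ using (ℚ)
open import Data.Rational.Properties using (+-*-commutativeRing)
open import Defs
open import Relation.Binary.Consequences using (dec⇒weaklyDec)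
open import Relation.Nullary using (yes; no)
open import Relation.Binary.PropositionalEquality using (_≡_; _≢_)
import Relation.Binary.PropositionalEquality as ≡
import Relation.Binary.Reasoning.Setoid as SetoidReasoning

IsGroupOn-⇔ : ∀ {a p p′ ℓ ℓ′} {A : Set a} {P : A → Set p} {P′ : A → Set p′}
              {_≈_ : A → A → Set ℓ} {_≈′_ : A → A → Set ℓ′} {_∙_ : A → A → A} {e : A} {inv : A → A} →
              (∀ {x} → P x → P′ x) → (∀ {x} → P′ x → P x) →
              (∀ {x y} → x ≈ y → x ≈′ y) → (∀ {x y} → x ≈′ y → x ≈ y) →
              IsGroupOn P _≈_ _∙_ e inv → IsGroupOn P′ _≈′_ _∙_ e inv
IsGroupOn-⇔ to from ≈⇒≈′ ≈′⇒≈ G = record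
  { ∙-closed   = λ x y → to (∙-closed (from x) (from y))
  ; e-closed   = to e-closed
  ; inv-closed = λ x → to (inv-closed (from x))
  ; ∙-cong     = λ x x′ y y′ x≈x′ y≈y′ → ≈⇒≈′ (∙-cong (from x) (from x′) (from y) (from y′) (≈′⇒≈ x≈x′) (≈′⇒≈ y≈y′))
  ; inv-cong   = λ x x′ x≈x′ → ≈⇒≈′ (inv-cong (from x) (from x′) (≈′⇒≈ x≈x′))
  ; assoc      = λ x y z → ≈⇒≈′ (assoc (from x) (from y) (from z))
  ; identityˡ  = λ x → ≈⇒≈′ (identityˡ (from x))
  ; identityʳ  = λ x → ≈⇒≈′ (identityʳ (from x))
  ; inverseˡ   = λ x → ≈⇒≈′ (inverseˡ (from x))
  ; inverseʳ   = λ x → ≈⇒≈′ (inverseʳ (from x)) }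
  where open IsGroupOn G

module QuadRiordanGroup {c ℓ} (R : CommutativeRing c ℓ) (inc : Containsℚ R) where
  open QuadRiordan R inc
  open CommutativeRing R
  open Containsℚ inc using (φ; isRingHom)
  open CommutativeSemigroupProperties +-commutativeSemigroup
    using () renaming (interchange to +-interchange; x∙yz≈y∙xz to x+yz≈y+xz)
  open RingProperties ring using (-0#≈0#)
  open GroupProperties +-group using () renaming (∙-cancelʳ to +-cancelʳ)
  module ≈R = SetoidReasoning setoid

  private
    module φ = RingMorphisms.IsRingHomomorphism isRingHom

  ℚ-embedding : CommutativeRing.rawRing +-*-commutativeRing
                  -Raw-AlmostCommutative⟶ fromCommutativeRing R
  ℚ-embedding = record
    { ⟦_⟧ = φ ; +-homo = φ.+-homo ; *-homo = φ.*-homo ; -‿homo = φ.-‿homo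
    ; 0-homo = φ.0#-homo ; 1-homo = φ.1#-homo }

  ℚ-equal? : ∀ p q → Maybe (φ p ≈ φ q)
  ℚ-equal? p q = Maybe.map (λ { ≡.refl → refl }) (dec⇒weaklyDec ℚ._≟_ p q)

  module ℚ-Solver = RingSolver (CommutativeRing.rawRing +-*-commutativeRing)
    (fromCommutativeRing R) ℚ-embedding ℚ-equal?

  Σ-cong : ∀ n {f g : ℕ → Carrier} → (∀ k → k < n → f k ≈ g k) → Σ< n f ≈ Σ< n g
  Σ-cong zero    f≈g = refl
  Σ-cong (suc n) f≈g = +-cong (Σ-cong n (λ k k<n → f≈g k (ℕ.m<n⇒m<1+n k<n))) (f≈g n ℕ.≤-refl)

  Σ-zero : ∀ n {f : ℕ → Carrier} → (∀ k → k < n → f k ≈ 0#) → Σ< n f ≈ 0#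
  Σ-zero n f≈0 = trans (Σ-cong n f≈0) (Σ-zero′ n)
    where
    Σ-zero′ : ∀ n → Σ< n (λ _ → 0#) ≈ 0#
    Σ-zero′ zero    = refl
    Σ-zero′ (suc n) = trans (+-identityʳ _) (Σ-zero′ n)

  Σ-+ : ∀ n (f g : ℕ → Carrier) → Σ< n (λ k → f k + g k) ≈ Σ< n f + Σ< n g
  Σ-+ zero    f g = sym (+-identityˡ 0#)
  Σ-+ (suc n) f g = trans (+-congʳ (Σ-+ n f g)) (+-interchange _ _ _ _)

  Σ-*ˡ : ∀ n a (f : ℕ → Carrier) → a * Σ< n f ≈ Σ< n (λ k → a * f k)
  Σ-*ˡ zero    a f = zeroʳ a
  Σ-*ˡ (suc n) a f = trans (distribˡ a _ _) (+-congʳ (Σ-*ˡ n a f))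

  Σ-front : ∀ n (f : ℕ → Carrier) → Σ< (suc n) f ≈ f 0 + Σ< n (λ k → f (suc k))
  Σ-front zero    f = trans (+-identityˡ _) (sym (+-identityʳ _))
  Σ-front (suc n) f = trans (+-congʳ (Σ-front n f)) (+-assoc _ _ _)

  -- The ring of formal power series

  -- Coefficientwise equality _≈ₛ_, wrapped in a record so that unification recovers the two series.
  infix 4 _≋_
  record _≋_ (f g : PS) : Set ℓ where
    constructor mk≋
    field coeff : ∀ n → f n ≈ g n
  open _≋_ public

  ≋-refl : ∀ {f} → f ≋ f
  ≋-refl .coeff n = refl

  ≋-sym : ∀ {f g} → f ≋ g → g ≋ f
  ≋-sym f≋g .coeff n = sym (coeff f≋g n)

  ≋-trans : ∀ {f g h} → f ≋ g → g ≋ h → f ≋ h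
  ≋-trans f≋g g≋h .coeff n = trans (coeff f≋g n) (coeff g≋h n)

  infixl 6 _⊕_
  _⊕_ : PS → PS → PS
  (f ⊕ g) n = f n + g n

  ⊖_ : PS → PS
  (⊖ f) n = - f n

  𝟘 : PS
  𝟘 _ = 0#

  C : Carrier → PS
  C a zero    = a
  C a (suc _) = 0#

  mul-at-0 : ∀ f g → mul f g 0 ≈ f 0 * g 0
  mul-at-0 f g = +-identityˡ _

  mul-at-suc : ∀ f g n → mul f g (suc n) ≈ f 0 * g (suc n) + mul (shift f) g n
  mul-at-suc f g n = Σ-front (suc n) (λ k → f k * g (suc n ∸ k))

  mul-at-1 : ∀ f g → mul f g 1 ≈ f 0 * g 1 + f 1 * g 0
  mul-at-1 f g = trans (mul-at-suc f g 0) (+-congˡ (mul-at-0 (shift f) g))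

  mul-cong : ∀ {f f′ g g′} → f ≋ f′ → g ≋ g′ → mul f g ≋ mul f′ g′
  mul-cong f≋f′ g≋g′ .coeff n =
    Σ-cong (suc n) (λ k _ → *-cong (coeff f≋f′ k) (coeff g≋g′ (n ∸ k)))

  mul-zeroˡ : ∀ g → mul 𝟘 g ≋ 𝟘
  mul-zeroˡ g .coeff n = Σ-zero (suc n) (λ k _ → zeroˡ _)

  mul-distribʳ : ∀ f f′ g → mul (f ⊕ f′) g ≋ mul f g ⊕ mul f′ g
  mul-distribʳ f f′ g .coeff n =
    trans (Σ-cong (suc n) (λ k _ → distribʳ _ _ _)) (Σ-+ (suc n) _ _)

  mul-C : ∀ a f → mul (C a) f ≋ (λ n → a * f n)
  mul-C a f .coeff zero    = mul-at-0 (C a) f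
  mul-C a f .coeff (suc n) =
    trans (mul-at-suc (C a) f n) (trans (+-congˡ (coeff (mul-zeroˡ f) n)) (+-identityʳ _))

  mul-identityˡ : ∀ g → mul one g ≋ g
  mul-identityˡ g .coeff zero    = trans (mul-at-0 one g) (*-identityˡ _)
  mul-identityˡ g .coeff (suc n) = trans (mul-at-suc one g n)
    (trans (+-cong (*-identityˡ _) (coeff (mul-zeroˡ g) n)) (+-identityʳ _))

  mul-comm : ∀ f g → mul f g ≋ mul g f
  mul-comm f g .coeff zero = +-congˡ (*-comm _ _)
  mul-comm f g .coeff (suc zero) = begin
    mul f g 1               ≈⟨ mul-at-1 f g ⟩
    f 0 * g 1 + f 1 * g 0   ≈⟨ +-comm _ _ ⟩
    f 1 * g 0 + f 0 * g 1   ≈⟨ +-cong (*-comm _ _) (*-comm _ _) ⟩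
    g 0 * f 1 + g 1 * f 0   ≈⟨ mul-at-1 g f ⟨
    mul g f 1               ∎
    where open ≈R
  mul-comm f g .coeff (suc (suc n)) = begin
    mul f g (2 +ℕ n)
      ≈⟨ mul-at-suc f g (suc n) ⟩
    f 0 * g (2 +ℕ n) + mul (shift f) g (suc n)
      ≈⟨ +-congˡ (coeff (mul-comm (shift f) g) (suc n)) ⟩
    f 0 * g (2 +ℕ n) + mul g (shift f) (suc n)
      ≈⟨ +-congˡ (mul-at-suc g (shift f) n) ⟩
    f 0 * g (2 +ℕ n) + (g 0 * f (2 +ℕ n) + mul (shift g) (shift f) n)
      ≈⟨ x+yz≈y+xz _ _ _ ⟩
    g 0 * f (2 +ℕ n) + (f 0 * g (2 +ℕ n) + mul (shift g) (shift f) n)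
      ≈⟨ +-congˡ (+-congˡ (coeff (mul-comm (shift g) (shift f)) n)) ⟩
    g 0 * f (2 +ℕ n) + (f 0 * g (2 +ℕ n) + mul (shift f) (shift g) n)
      ≈⟨ +-congˡ (mul-at-suc f (shift g) n) ⟨
    g 0 * f (2 +ℕ n) + mul f (shift g) (suc n)
      ≈⟨ +-congˡ (coeff (mul-comm f (shift g)) (suc n)) ⟩
    g 0 * f (2 +ℕ n) + mul (shift g) f (suc n)
      ≈⟨ mul-at-suc g f (suc n) ⟨
    mul g f (2 +ℕ n)
      ∎
    where open ≈R

  shift-mul : ∀ f g → shift (mul f g) ≋ (λ n → f 0 * shift g n) ⊕ mul (shift f) g
  shift-mul f g .coeff n = mul-at-suc f g n

  mul-scaleˡ : ∀ a f g → mul (λ k → a * f k) g ≋ (λ n → a * mul f g n)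
  mul-scaleˡ a f g .coeff n =
    trans (Σ-cong (suc n) (λ k _ → *-assoc _ _ _)) (sym (Σ-*ˡ (suc n) a _))

  mul-scaleʳ : ∀ a f g → mul f (λ k → a * g k) ≋ (λ n → a * mul f g n)
  mul-scaleʳ a f g = ≋-trans (mul-comm f _)
    (≋-trans (mul-scaleˡ a g f) (mk≋ λ n → *-congˡ (coeff (mul-comm g f) n)))

  mul-assoc : ∀ f g h → mul (mul f g) h ≋ mul f (mul g h)
  mul-assoc f g h .coeff zero = begin
    mul (mul f g) h 0     ≈⟨ trans (mul-at-0 (mul f g) h) (*-congʳ (mul-at-0 f g)) ⟩
    (f 0 * g 0) * h 0     ≈⟨ *-assoc _ _ _ ⟩
    f 0 * (g 0 * h 0)     ≈⟨ trans (mul-at-0 f (mul g h)) (*-congˡ (mul-at-0 g h)) ⟨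
    mul f (mul g h) 0     ∎
    where open ≈R
  mul-assoc f g h .coeff (suc n) = begin
    mul (mul f g) h (suc n)
      ≈⟨ mul-at-suc (mul f g) h n ⟩
    mul f g 0 * h (suc n) + mul (shift (mul f g)) h n
      ≈⟨ +-cong (*-congʳ (mul-at-0 f g)) (coeff (mul-cong (shift-mul f g) (≋-refl {h})) n) ⟩
    (f 0 * g 0) * h (suc n) + mul ((λ k → f 0 * shift g k) ⊕ mul (shift f) g) h n
      ≈⟨ +-congˡ (coeff (mul-distribʳ _ _ h) n) ⟩
    (f 0 * g 0) * h (suc n) + (mul (λ k → f 0 * shift g k) h n + mul (mul (shift f) g) h n)
      ≈⟨ +-congˡ (+-cong (coeff (mul-scaleˡ (f 0) (shift g) h) n) (coeff (mul-assoc (shift f) g h) n)) ⟩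
    (f 0 * g 0) * h (suc n) + (f 0 * mul (shift g) h n + mul (shift f) (mul g h) n)
      ≈⟨ rearrange _ _ _ _ _ ⟩
    f 0 * (g 0 * h (suc n) + mul (shift g) h n) + mul (shift f) (mul g h) n
      ≈⟨ +-congʳ (*-congˡ (mul-at-suc g h n)) ⟨
    f 0 * mul g h (suc n) + mul (shift f) (mul g h) n
      ≈⟨ mul-at-suc f (mul g h) n ⟨
    mul f (mul g h) (suc n)
      ∎
    where
    open ≈R
    rearrange : ∀ a b c x y → (a * b) * c + (a * x + y) ≈ a * (b * c + x) + y
    rearrange = solve 5 (λ a b c x y → (a :* b) :* c :+ (a :* x :+ y) := a :* (b :* c :+ x) :+ y) refl
      where open ℚ-Solver

  PS-isCommutativeRing : IsCommutativeRing _≋_ _⊕_ mul ⊖_ 𝟘 one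
  PS-isCommutativeRing = record
    { isRing = record
      { +-isAbelianGroup = record
        { isGroup = record
          { isMonoid = record
            { isSemigroup = record
              { isMagma = record
                { isEquivalence = record { refl = ≋-refl ; sym = ≋-sym ; trans = ≋-trans }
                ; ∙-cong = λ f≋f′ g≋g′ → mk≋ λ n → +-cong (coeff f≋f′ n) (coeff g≋g′ n) }
              ; assoc = λ f g h → mk≋ λ n → +-assoc (f n) (g n) (h n) }
            ; identity = (λ f → mk≋ λ n → +-identityˡ (f n)) , (λ f → mk≋ λ n → +-identityʳ (f n)) }
          ; inverse = (λ f → mk≋ λ n → -‿inverseˡ (f n)) , (λ f → mk≋ λ n → -‿inverseʳ (f n))
          ; ⁻¹-cong = λ f≋f′ → mk≋ λ n → -‿cong (coeff f≋f′ n) }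
        ; comm = λ f g → mk≋ λ n → +-comm (f n) (g n) }
      ; *-cong = mul-cong
      ; *-assoc = mul-assoc
      ; *-identity = mul-identityˡ , λ f → ≋-trans (mul-comm f one) (mul-identityˡ f)
      ; distrib = (λ f g h → ≋-trans (mul-comm f (g ⊕ h)) (≋-trans (mul-distribʳ g h f)
                                 (mk≋ λ n → +-cong (coeff (mul-comm g f) n) (coeff (mul-comm h f) n))))
                , (λ f g h → mul-distribʳ g h f) }
    ; *-comm = mul-comm }

  PS-commutativeRing : CommutativeRing c ℓ
  PS-commutativeRing = record { isCommutativeRing = PS-isCommutativeRing }

  module ℙ = CommutativeRing PS-commutativeRing
  module ≋-Reasoning = SetoidReasoning ℙ.setoid
  module ℙ-Solver = NaturalCoefficientsSolver ℙ.commutativeSemiring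

  C-cong : ∀ {a b} → a ≈ b → C a ≋ C b
  C-cong a≈b .coeff zero    = a≈b
  C-cong a≈b .coeff (suc n) = refl

  C-* : ∀ a b → C (a * b) ≋ mul (C a) (C b)
  C-* a b = ≋-sym (≋-trans (mul-C a (C b)) (mk≋ scaled))
    where
    scaled : ∀ n → a * C b n ≈ C (a * b) n
    scaled zero    = refl
    scaled (suc n) = zeroʳ a

  scale-one : ∀ a n → a * one n ≈ C a n
  scale-one a zero    = *-identityʳ a
  scale-one a (suc n) = zeroʳ a

  C-one : C 1# ≋ one
  C-one .coeff zero    = refl
  C-one .coeff (suc n) = refl

  pow-cong : ∀ k {f f′} → f ≋ f′ → pow f k ≋ pow f′ k
  pow-cong zero    f≋f′ = ≋-refl
  pow-cong (suc k) f≋f′ = mul-cong f≋f′ (pow-cong k f≋f′)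

  pow-at-0 : ∀ {f} → f 0 ≈ 1# → ∀ k → pow f k 0 ≈ 1#
  pow-at-0 f0 zero    = refl
  pow-at-0 {f} f0 (suc k) =
    trans (mul-at-0 f (pow f k)) (trans (*-cong f0 (pow-at-0 f0 k)) (*-identityˡ 1#))

  shift-X : shift X ≋ one
  shift-X .coeff zero    = refl
  shift-X .coeff (suc n) = refl

  mul-X-at-0 : ∀ g → mul X g 0 ≈ 0#
  mul-X-at-0 g = trans (mul-at-0 X g) (zeroˡ _)

  mul-X-at-suc : ∀ g n → mul X g (suc n) ≈ g n
  mul-X-at-suc g n = trans (mul-at-suc X g n) (trans (+-cong (zeroˡ _)
    (coeff (≋-trans (mul-cong shift-X (≋-refl {g})) (mul-identityˡ g)) n)) (+-identityˡ _))

  X-mul-shift : ∀ f → f 0 ≈ 0# → mul X (shift f) ≋ f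
  X-mul-shift f f0 .coeff zero    = trans (mul-X-at-0 (shift f)) (sym f0)
  X-mul-shift f f0 .coeff (suc n) = mul-X-at-suc (shift f) n

  X-mul-cancel : ∀ {f g} → mul X f ≋ mul X g → f ≋ g
  X-mul-cancel {f} {g} Xf≋Xg .coeff n =
    trans (sym (mul-X-at-suc f n)) (trans (coeff Xf≋Xg (suc n)) (mul-X-at-suc g n))

  mul-pow-X-at : ∀ k f n → mul (pow X k) f (k +ℕ n) ≈ f n
  mul-pow-X-at zero    f n = coeff (mul-identityˡ f) n
  mul-pow-X-at (suc k) f n = trans (coeff (mul-assoc X (pow X k) f) (suc k +ℕ n))
    (trans (mul-X-at-suc (mul (pow X k) f) (k +ℕ n)) (mul-pow-X-at k f n))

  pow-X-cancel : ∀ k {f g} → mul (pow X k) f ≋ mul (pow X k) g → f ≋ g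
  pow-X-cancel k {f} {g} e .coeff n =
    trans (sym (mul-pow-X-at k f n)) (trans (coeff e (k +ℕ n)) (mul-pow-X-at k g n))

  open CommutativeMonoidSum ℙ.*-commutativeMonoid public
    using () renaming (sum to ∏; sum-cong-≋ to ∏-cong; ∑-distrib-+ to ∏-distrib)

  ∏-const : ∀ n h → ∏ {n} (λ _ → h) ≋ pow h n
  ∏-const zero    h = ≋-refl
  ∏-const (suc n) h = ℙ.*-congˡ {h} (∏-const n h)

  ∏-at-0 : ∀ {n} (v : Fin n → PS) → (∀ i → v i 0 ≈ 1#) → ∏ v 0 ≈ 1#
  ∏-at-0 {zero}  v v0 = refl
  ∏-at-0 {suc n} v v0 = trans (mul-at-0 (v Fin.zero) (∏ (λ i → v (Fin.suc i))))
    (trans (*-cong (v0 Fin.zero) (∏-at-0 (λ i → v (Fin.suc i)) (λ i → v0 (Fin.suc i)))) (*-identityˡ 1#))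

  infix 4 _≈[<_]_
  record _≈[<_]_ (f : PS) (n : ℕ) (g : PS) : Set ℓ where
    constructor agree
    field below : ∀ i → i < n → f i ≈ g i
  open _≈[<_]_ public

  ≈[<]-refl : ∀ {f n} → f ≈[< n ] f
  ≈[<]-refl = agree λ _ _ → refl

  mul-agree : ∀ {n f f′ g g′} → f ≈[< n ] f′ → g ≈[< n ] g′ → mul f g ≈[< n ] mul f′ g′
  mul-agree f≈f′ g≈g′ .below i i<n = Σ-cong (suc i) λ k k≤i →
    *-cong (below f≈f′ k (ℕ.≤-trans k≤i i<n)) (below g≈g′ (i ∸ k) (ℕ.≤-<-trans (ℕ.m∸n≤m i k) i<n))

  pow-agree : ∀ {n f f′} k → f ≈[< n ] f′ → pow f k ≈[< n ] pow f′ k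
  pow-agree zero    f≈f′ = ≈[<]-refl
  pow-agree (suc k) f≈f′ = mul-agree f≈f′ (pow-agree k f≈f′)

  mul-agree-suc : ∀ {n h g g′} → h 0 ≈ 0# → g ≈[< n ] g′ → mul h g ≈[< suc n ] mul h g′
  mul-agree-suc {h = h} {g} {g′} h0 g≈g′ .below zero _ =
    trans (mul-at-0 h g) (trans (*-congʳ h0) (trans (zeroˡ _)
      (sym (trans (mul-at-0 h g′) (trans (*-congʳ h0) (zeroˡ _))))))
  mul-agree-suc {h = h} {g} {g′} h0 g≈g′ .below (suc i) (s≤s i<n) =
    trans (mul-at-suc h g i) (trans (+-cong (trans (*-congʳ h0) (trans (zeroˡ _)
      (sym (trans (*-congʳ h0) (zeroˡ _))))) (below (mul-agree ≈[<]-refl g≈g′) i i<n))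
      (sym (mul-at-suc h g′ i)))

  pow-vanish : ∀ {h} → h 0 ≈ 0# → ∀ k n → n < k → pow h k n ≈ 0#
  pow-vanish {h} h0 (suc k) n n<1+k =
    trans (below (mul-agree-suc h0 (agree (pow-vanish h0 k))) n n<1+k) (coeff (ℙ.zeroʳ h) n)

  pow-agree-suc : ∀ {a b n} → a 0 ≈ 0# → b 0 ≈ 0# → a ≈[< suc n ] b →
                  ∀ k → pow a (2 +ℕ k) (suc n) ≈ pow b (2 +ℕ k) (suc n)
  pow-agree-suc {a} {b} {n} a0 b0 a≈b k = trans (inner a0) (trans
    (Σ-cong n (λ j j<n → *-cong (below a≈b (suc j) (s≤s j<n))
                                (below (pow-agree (suc k) a≈b) (n ∸ j) (s≤s (ℕ.m∸n≤m n j)))))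
    (sym (inner b0)))
    where
    -- With c₀ = 0, the outer terms c₀ · (cᵏ⁺¹)ₙ₊₁ and cₙ₊₁ · (cᵏ⁺¹)₀ of (c · cᵏ⁺¹)ₙ₊₁ vanish.
    inner : ∀ {c} → c 0 ≈ 0# → pow c (2 +ℕ k) (suc n) ≈ Σ< n (λ j → c (suc j) * pow c (suc k) (n ∸ j))
    inner {c} c0 = begin
      mul c P (suc n)
        ≈⟨ mul-at-suc c P n ⟩
      c 0 * P (suc n) + (Σ< n (λ j → c (suc j) * P (n ∸ j)) + c (suc n) * P (n ∸ n))
        ≈⟨ +-cong (trans (*-congʳ c0) (zeroˡ _)) (+-congˡ (trans (*-congˡ P-at-0) (zeroʳ _))) ⟩
      0# + (Σ< n (λ j → c (suc j) * P (n ∸ j)) + 0#)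
        ≈⟨ trans (+-identityˡ _) (+-identityʳ _) ⟩
      Σ< n (λ j → c (suc j) * P (n ∸ j))
        ∎
      where
      open ≈R
      P = pow c (suc k)
      P-at-0 : P (n ∸ n) ≈ 0#
      P-at-0 = trans (reflexive (≡.cong P (ℕ.n∸n≡0 n))) (pow-vanish c0 (suc k) 0 (s≤s z≤n))

  mul-at-top : ∀ {f f′ n} g → f′ ≈[< n ] f → f′ n ≈ 0# → mul f g n ≈ mul f′ g n + f n * g 0
  mul-at-top {f} {f′} {n} g f′≈f f′n = begin
    Σ< n (λ k → f k * g (n ∸ k)) + f n * g (n ∸ n)
      ≈⟨ +-cong (Σ-cong n (λ k k<n → *-congʳ (sym (below f′≈f k k<n)))) (*-congˡ g0) ⟩
    Σ< n (λ k → f′ k * g (n ∸ k)) + f n * g 0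
      ≈⟨ +-congʳ (trans (+-congˡ (trans (*-congʳ f′n) (zeroˡ _))) (+-identityʳ _)) ⟨
    (Σ< n (λ k → f′ k * g (n ∸ k)) + f′ n * g (n ∸ n)) + f n * g 0
      ∎
    where
    open ≈R
    g0 : g (n ∸ n) ≈ g 0
    g0 = reflexive (≡.cong g (ℕ.n∸n≡0 n))

  prefix-below : ∀ step {n i} → i < n → prefix step n i ≡ seqRec step i
  prefix-below step {suc n} {i} i<1+n with i ℕ.≟ n
  ... | yes ≡.refl = ≡.refl
  ... | no i≢n     = prefix-below step (ℕ.≤∧≢⇒< (ℕ.≤-pred i<1+n) i≢n)

  prefix-above : ∀ step {n i} → n ≤ i → prefix step n i ≡ 0#
  prefix-above step {zero}      _     = ≡.refl
  prefix-above step {suc n} {i} 1+n≤i with i ℕ.≟ n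
  ... | yes ≡.refl = ⊥-elim (ℕ.<-irrefl ≡.refl 1+n≤i)
  ... | no _       = prefix-above step (ℕ.≤-trans (ℕ.n≤1+n n) 1+n≤i)

  prefix-agree : ∀ step n → prefix step n ≈[< n ] seqRec step
  prefix-agree step n .below i i<n = reflexive (prefix-below step i<n)

  prefix-cong : ∀ {s s′} → (∀ m v → s m v ≈ s′ m v) → (∀ m {v v′} → v ≋ v′ → s′ m v ≈ s′ m v′) →
                ∀ n → prefix s n ≋ prefix s′ n
  prefix-cong s≈s′ s′-cong zero .coeff i = refl
  prefix-cong s≈s′ s′-cong (suc n) .coeff i with i ℕ.≟ n
  ... | yes _ = trans (s≈s′ n _) (s′-cong n (prefix-cong s≈s′ s′-cong n))
  ... | no  _ = coeff (prefix-cong s≈s′ s′-cong n) i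

  -- Composition

  compUpTo : ℕ → PS → PS → PS
  compUpTo N g h n = Σ< N (λ k → g k * pow h k n)

  compUpTo-agree : ∀ {h} → h 0 ≈ 0# → ∀ N g → compUpTo N g h ≈[< N ] comp g h
  compUpTo-agree {h} h0 N g .below n n<N = stable (ℕ.≤⇒≤′ n<N)
    where
    stable : ∀ {N} → suc n ≤′ N → compUpTo N g h n ≈ comp g h n
    stable ≤′-refl             = refl
    stable (≤′-step {N} n<′N) = trans
      (+-cong (stable n<′N) (trans (*-congˡ (pow-vanish h0 N n (ℕ.≤′⇒≤ n<′N))) (zeroʳ _)))
      (+-identityʳ _)

  compUpTo-suc : ∀ N g h → compUpTo (suc N) g h ≋ C (g 0) ⊕ mul h (compUpTo N (shift g) h)
  compUpTo-suc zero g h .coeff n =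
    trans (+-identityˡ _) (trans (scale-one (g 0) n) (sym (trans (+-congˡ (coeff (ℙ.zeroʳ h) n)) (+-identityʳ _))))
  compUpTo-suc (suc N) g h .coeff n = begin
    compUpTo (suc N) g h n + g (suc N) * mul h (pow h N) n
      ≈⟨ +-congʳ (coeff (compUpTo-suc N g h) n) ⟩
    (C (g 0) n + mul h (compUpTo N (shift g) h) n) + g (suc N) * mul h (pow h N) n
      ≈⟨ +-assoc _ _ _ ⟩
    C (g 0) n + (mul h (compUpTo N (shift g) h) n + g (suc N) * mul h (pow h N) n)
      ≈⟨ +-congˡ (+-congˡ (sym (coeff (mul-scaleʳ (g (suc N)) h (pow h N)) n))) ⟩
    C (g 0) n + (mul h (compUpTo N (shift g) h) n + mul h (λ m → g (suc N) * pow h N m) n)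
      ≈⟨ +-congˡ (sym (coeff (ℙ.distribˡ h (compUpTo N (shift g) h) (λ m → g (suc N) * pow h N m)) n)) ⟩
    C (g 0) n + mul h (compUpTo (suc N) (shift g) h) n
      ∎
    where open ≈R

  comp-unfold : ∀ {h} → h 0 ≈ 0# → ∀ g → comp g h ≋ C (g 0) ⊕ mul h (comp (shift g) h)
  comp-unfold {h} h0 g .coeff n = begin
    comp g h n
      ≈⟨ below (compUpTo-agree h0 (2 +ℕ n) g) n (ℕ.m<n⇒m<1+n ℕ.≤-refl) ⟨
    compUpTo (suc (suc n)) g h n
      ≈⟨ coeff (compUpTo-suc (suc n) g h) n ⟩
    C (g 0) n + mul h (compUpTo (suc n) (shift g) h) n
      ≈⟨ +-congˡ (below (mul-agree ≈[<]-refl (compUpTo-agree h0 (suc n) (shift g))) n ℕ.≤-refl) ⟩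
    C (g 0) n + mul h (comp (shift g) h) n
      ∎
    where open ≈R

  comp-cong : ∀ {g g′ h h′} → g ≋ g′ → h ≋ h′ → comp g h ≋ comp g′ h′
  comp-cong g≋g′ h≋h′ .coeff n =
    Σ-cong (suc n) (λ k _ → *-cong (coeff g≋g′ k) (coeff (pow-cong k h≋h′) n))

  comp-at-0 : ∀ g h → comp g h 0 ≈ g 0
  comp-at-0 g h = trans (+-identityˡ _) (*-identityʳ _)

  comp-at-1 : ∀ {h} → h 0 ≈ 0# → ∀ g → comp g h 1 ≈ g 1 * h 1
  comp-at-1 {h} h0 g = begin
    comp g h 1                                       ≈⟨ coeff (comp-unfold {h} h0 g) 1 ⟩
    0# + mul h (comp (shift g) h) 1                  ≈⟨ +-identityˡ _ ⟩
    mul h (comp (shift g) h) 1                       ≈⟨ mul-at-1 h (comp (shift g) h) ⟩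
    h 0 * comp (shift g) h 1 + h 1 * comp (shift g) h 0
      ≈⟨ +-cong (trans (*-congʳ h0) (zeroˡ _)) (*-congˡ (comp-at-0 (shift g) h)) ⟩
    0# + h 1 * g 1                                   ≈⟨ trans (+-identityˡ _) (*-comm _ _) ⟩
    g 1 * h 1                                        ∎
    where open ≈R

  comp-⊕ : ∀ f g h → comp (f ⊕ g) h ≋ comp f h ⊕ comp g h
  comp-⊕ f g h .coeff n = trans (Σ-cong (suc n) (λ k _ → distribʳ _ _ _)) (Σ-+ (suc n) _ _)

  comp-C : ∀ a h → comp (C a) h ≋ C a
  comp-C a h .coeff n =
    trans (Σ-front n _) (trans (+-cong (scale-one a n) (Σ-zero n (λ k _ → zeroˡ _))) (+-identityʳ _))

  comp-one : ∀ h → comp one h ≋ one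
  comp-one h = ≋-trans (comp-cong (≋-sym C-one) ≋-refl) (≋-trans (comp-C 1# h) C-one)

  -- Strong induction on the index: Horner's rule reduces f · g to C f₀ · shift g and shift f · g.
  comp-mul : ∀ {h} → h 0 ≈ 0# → ∀ f g → comp (mul f g) h ≋ mul (comp f h) (comp g h)
  comp-mul {h} h0 f g .coeff n = <-rec P step n f g
    where
    P : ℕ → Set _
    P n = ∀ f g → comp (mul f g) h n ≈ mul (comp f h) (comp g h) n
    step : ∀ n → (∀ {i} → i < n → P i) → P n
    step n IH f g =
      trans (coeff (comp-unfold {h} h0 (mul f g)) n)
            (trans (+-congˡ (below (mul-agree-suc h0 shifted) n ℕ.≤-refl)) (coeff regroup n))
      where
      F′ = comp (shift f) h
      G′ = comp (shift g) h
      shifted : comp (shift (mul f g)) h ≈[< n ] mul (C (f 0)) G′ ⊕ mul F′ (comp g h)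
      shifted .below i i<n = begin
        comp (shift (mul f g)) h i
          ≈⟨ coeff (comp-cong (shift-mul f g) ≋-refl) i ⟩
        comp ((λ k → f 0 * shift g k) ⊕ mul (shift f) g) h i
          ≈⟨ coeff (comp-⊕ (λ k → f 0 * shift g k) (mul (shift f) g) h) i ⟩
        comp (λ k → f 0 * shift g k) h i + comp (mul (shift f) g) h i
          ≈⟨ +-cong (coeff (comp-cong (≋-sym (mul-C (f 0) (shift g))) (≋-refl {h})) i) (IH i<n (shift f) g) ⟩
        comp (mul (C (f 0)) (shift g)) h i + mul F′ (comp g h) i
          ≈⟨ +-congʳ (trans (IH i<n (C (f 0)) (shift g)) (coeff (mul-cong (comp-C (f 0) h) (≋-refl {G′})) i)) ⟩
        mul (C (f 0)) G′ i + mul F′ (comp g h) i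
          ∎
        where open ≈R
      regroup : C (mul f g 0) ⊕ mul h (mul (C (f 0)) G′ ⊕ mul F′ (comp g h)) ≋ mul (comp f h) (comp g h)
      regroup = begin
        C (mul f g 0) ⊕ mul h (mul (C (f 0)) G′ ⊕ mul F′ (comp g h))
          ≈⟨ ℙ.+-cong (≋-trans (C-cong (mul-at-0 f g)) (C-* (f 0) (g 0)))
                      (ℙ.*-congˡ {h} (ℙ.+-congˡ {mul (C (f 0)) G′} (ℙ.*-congˡ {F′} (comp-unfold {h} h0 g)))) ⟩
        mul (C (f 0)) (C (g 0)) ⊕ mul h (mul (C (f 0)) G′ ⊕ mul F′ (C (g 0) ⊕ mul h G′))
          ≈⟨ expand (C (f 0)) (C (g 0)) h F′ G′ ⟩
        mul (C (f 0) ⊕ mul h F′) (C (g 0) ⊕ mul h G′)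
          ≈⟨ mul-cong (comp-unfold h0 f) (comp-unfold h0 g) ⟨
        mul (comp f h) (comp g h)
          ∎
        where
        open ≋-Reasoning
        expand : ∀ a b h A B → mul a b ⊕ mul h (mul a B ⊕ mul A (b ⊕ mul h B)) ≋ mul (a ⊕ mul h A) (b ⊕ mul h B)
        expand = solve 5 (λ a b h A B → a :* b :+ h :* (a :* B :+ A :* (b :+ h :* B))
                                        := (a :+ h :* A) :* (b :+ h :* B)) ℙ.refl
          where open ℙ-Solver

  comp-pow : ∀ {h} → h 0 ≈ 0# → ∀ f k → comp (pow f k) h ≋ pow (comp f h) k
  comp-pow {h} h0 f zero    = comp-one h
  comp-pow {h} h0 f (suc k) = ≋-trans (comp-mul h0 f (pow f k)) (ℙ.*-congˡ (comp-pow h0 f k))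

  comp-∏ : ∀ {h} → h 0 ≈ 0# → ∀ {n} (v : Fin n → PS) → comp (∏ v) h ≋ ∏ (λ i → comp (v i) h)
  comp-∏ {h} h0 {zero}  v = comp-one h
  comp-∏ {h} h0 {suc n} v = ≋-trans (comp-mul h0 (v Fin.zero) (∏ (λ i → v (Fin.suc i))))
                                    (ℙ.*-congˡ (comp-∏ h0 (λ i → v (Fin.suc i))))

  comp-X-right : ∀ g → comp g X ≋ g
  comp-X-right g .coeff n = at n g
    where
    at : ∀ n g → comp g X n ≈ g n
    at zero    g = comp-at-0 g X
    at (suc n) g = trans (coeff (comp-unfold {X} refl g) (suc n))
      (trans (+-identityˡ _) (trans (mul-X-at-suc (comp (shift g) X) n) (at n (shift g))))

  comp-X-left : ∀ {h} → h 0 ≈ 0# → comp X h ≋ h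
  comp-X-left {h} h0 = begin
    comp X h                               ≈⟨ comp-unfold h0 X ⟩
    C 0# ⊕ mul h (comp (shift X) h)        ≈⟨ ℙ.+-congˡ (ℙ.*-congˡ (≋-trans (comp-cong shift-X ≋-refl) (comp-one h))) ⟩
    C 0# ⊕ mul h one                       ≈⟨ ℙ.+-cong C-zero (ℙ.*-identityʳ h) ⟩
    𝟘 ⊕ h                                  ≈⟨ ℙ.+-identityˡ h ⟩
    h                                      ∎
    where
    open ≋-Reasoning
    C-zero : C 0# ≋ 𝟘
    C-zero .coeff zero    = refl
    C-zero .coeff (suc n) = refl

  comp-assoc : ∀ {h k} → h 0 ≈ 0# → k 0 ≈ 0# → ∀ g → comp (comp g h) k ≋ comp g (comp h k)
  comp-assoc {h} {k} h0 k0 g .coeff n = <-rec P step n g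
    where
    H = comp h k
    H0 : H 0 ≈ 0#
    H0 = trans (comp-at-0 h k) h0
    P : ℕ → Set _
    P n = ∀ g → comp (comp g h) k n ≈ comp g H n
    step : ∀ n → (∀ {i} → i < n → P i) → P n
    step n IH g = begin
      comp (comp g h) k n
        ≈⟨ coeff unfolded n ⟩
      C (g 0) n + mul H (comp (comp (shift g) h) k) n
        ≈⟨ +-congˡ (below (mul-agree-suc H0 (agree λ i i<n → IH i<n (shift g))) n ℕ.≤-refl) ⟩
      C (g 0) n + mul H (comp (shift g) H) n
        ≈⟨ coeff (comp-unfold {H} H0 g) n ⟨
      comp g H n
        ∎
      where
      open ≈R
      unfolded : comp (comp g h) k ≋ C (g 0) ⊕ mul H (comp (comp (shift g) h) k)
      unfolded = ≋-trans (comp-cong (comp-unfold h0 g) (≋-refl {k})) (≋-trans (comp-⊕ _ _ k)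
                   (ℙ.+-cong (comp-C (g 0) k) (comp-mul k0 h (comp (shift g) h))))

  -- Both components of the product in 𝒬 have the form p · q(h); this is their associativity.
  twisted-assoc : ∀ {h k} → h 0 ≈ 0# → k 0 ≈ 0# → ∀ p q r →
                  mul (mul p (comp q h)) (comp r (comp k h)) ≋ mul p (comp (mul q (comp r k)) h)
  twisted-assoc {h} {k} h0 k0 p q r = begin
    mul (mul p (comp q h)) (comp r (comp k h))   ≈⟨ ℙ.*-assoc p (comp q h) (comp r (comp k h)) ⟩
    mul p (mul (comp q h) (comp r (comp k h)))   ≈⟨ ℙ.*-congˡ {p} (ℙ.*-congˡ {comp q h} (comp-assoc k0 h0 r)) ⟨
    mul p (mul (comp q h) (comp (comp r k) h))   ≈⟨ ℙ.*-congˡ {p} (comp-mul h0 q (comp r k)) ⟨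
    mul p (comp (mul q (comp r k)) h)            ∎
    where open ≋-Reasoning

  -- Reciprocals, and division by series x + ⋯

  recip-at-suc : ∀ g n → recip₁ g (suc n) ≈ - Σ< (suc n) (λ k → g (suc n ∸ k) * recip₁ g k)
  recip-at-suc g n = -‿cong (Σ-cong (suc n) (λ k k<1+n → *-congˡ (below (prefix-agree _ (suc n)) k k<1+n)))

  recip-inverseˡ : ∀ g → g 0 ≈ 1# → mul (recip₁ g) g ≋ one
  recip-inverseˡ g g0 .coeff zero    = trans (mul-at-0 (recip₁ g) g) (trans (*-identityˡ _) g0)
  recip-inverseˡ g g0 .coeff (suc n) = begin
    Σ< (suc n) (λ k → recip₁ g k * g (suc n ∸ k)) + recip₁ g (suc n) * g (n ∸ n)
      ≈⟨ +-cong (Σ-cong (suc n) (λ k _ → *-comm _ _))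
                (*-cong (recip-at-suc g n) (trans (reflexive (≡.cong g (ℕ.n∸n≡0 n))) g0)) ⟩
    S + (- S) * 1#
      ≈⟨ trans (+-congˡ (*-identityʳ _)) (-‿inverseʳ S) ⟩
    0#
      ∎
    where
    open ≈R
    S = Σ< (suc n) (λ k → g (suc n ∸ k) * recip₁ g k)

  recip-inverseʳ : ∀ g → g 0 ≈ 1# → mul g (recip₁ g) ≋ one
  recip-inverseʳ g g0 = ≋-trans (mul-comm g (recip₁ g)) (recip-inverseˡ g g0)

  unit-cancelʳ : ∀ {w f g} → w 0 ≈ 1# → mul f w ≋ mul g w → f ≋ g
  unit-cancelʳ {w} {f} {g} w0 fw≋gw = begin
    f                           ≈⟨ ℙ.*-identityʳ f ⟨
    mul f one                   ≈⟨ ℙ.*-congˡ {f} (recip-inverseʳ w w0) ⟨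
    mul f (mul w (recip₁ w))    ≈⟨ mul-assoc f w (recip₁ w) ⟨
    mul (mul f w) (recip₁ w)    ≈⟨ ℙ.*-congʳ {recip₁ w} fw≋gw ⟩
    mul (mul g w) (recip₁ w)    ≈⟨ mul-assoc g w (recip₁ w) ⟩
    mul g (mul w (recip₁ w))    ≈⟨ ℙ.*-congˡ {g} (recip-inverseʳ w w0) ⟩
    mul g one                   ≈⟨ ℙ.*-identityʳ g ⟩
    g                           ∎
    where open ≋-Reasoning

  recip-unique : ∀ {g f} → g 0 ≈ 1# → mul f g ≋ one → f ≋ recip₁ g
  recip-unique {g} g0 fg≋1 = unit-cancelʳ {g} g0 (≋-trans fg≋1 (≋-sym (recip-inverseˡ g g0)))

  recip-cong : ∀ {g g′} → g ≋ g′ → g 0 ≈ 1# → recip₁ g ≋ recip₁ g′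
  recip-cong {g} {g′} g≋g′ g0 = recip-unique (trans (sym (coeff g≋g′ 0)) g0)
    (≋-trans (ℙ.*-congˡ (≋-sym g≋g′)) (recip-inverseˡ g g0))

  comp-recip : ∀ {h g} → h 0 ≈ 0# → g 0 ≈ 1# → comp (recip₁ g) h ≋ recip₁ (comp g h)
  comp-recip {h} {g} h0 g0 = recip-unique (trans (comp-at-0 g h) g0)
    (≋-trans (≋-sym (comp-mul h0 (recip₁ g) g))
             (≋-trans (comp-cong (recip-inverseˡ g g0) ≋-refl) (comp-one h)))

  record X+⋯ (h : PS) : Set ℓ where
    field
      coeff₀ : h 0 ≈ 0#
      coeff₁ : h 1 ≈ 1#
  open X+⋯ public

  X+⋯-X : X+⋯ X
  X+⋯-X = record { coeff₀ = refl ; coeff₁ = refl }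

  X+⋯-≋ : ∀ {h h′} → h ≋ h′ → X+⋯ h → X+⋯ h′
  X+⋯-≋ h≋h′ hX = record
    { coeff₀ = trans (sym (coeff h≋h′ 0)) (coeff₀ hX) ; coeff₁ = trans (sym (coeff h≋h′ 1)) (coeff₁ hX) }

  X+⋯-split : ∀ {h} → X+⋯ h → h ≋ mul X (shift h)
  X+⋯-split {h} hX = ≋-sym (X-mul-shift h (coeff₀ hX))

  X+⋯-cancelʳ : ∀ {k f g} → X+⋯ k → mul f k ≋ mul g k → f ≋ g
  X+⋯-cancelʳ {k} {f} {g} kX fk≋gk = unit-cancelʳ {shift k} (coeff₁ kX) (X-mul-cancel (begin
    mul X (mul f (shift k))    ≈⟨ x∙yz≈y∙xz X f (shift k) ⟩
    mul f (mul X (shift k))    ≈⟨ ℙ.*-congˡ {f} (X+⋯-split kX) ⟨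
    mul f k                    ≈⟨ fk≋gk ⟩
    mul g k                    ≈⟨ ℙ.*-congˡ {g} (X+⋯-split kX) ⟩
    mul g (mul X (shift k))    ≈⟨ x∙yz≈y∙xz g X (shift k) ⟩
    mul X (mul g (shift k))    ∎))
    where
    open ≋-Reasoning
    open CommutativeSemigroupProperties ℙ.*-commutativeSemigroup using (x∙yz≈y∙xz)

  X+⋯-pow-cancelʳ : ∀ {h} → X+⋯ h → ∀ k {f g} → mul f (pow h k) ≋ mul g (pow h k) → f ≋ g
  X+⋯-pow-cancelʳ {h} hX zero    {f} {g} e = begin
    f          ≈⟨ ℙ.*-identityʳ f ⟨
    mul f one  ≈⟨ e ⟩
    mul g one  ≈⟨ ℙ.*-identityʳ g ⟩
    g          ∎
    where open ≋-Reasoning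
  X+⋯-pow-cancelʳ {h} hX (suc k) {f} {g} e = X+⋯-cancelʳ hX (X+⋯-pow-cancelʳ hX k (begin
    mul (mul f h) (pow h k)    ≈⟨ ℙ.*-assoc f h (pow h k) ⟩
    mul f (pow h (suc k))      ≈⟨ e ⟩
    mul g (pow h (suc k))      ≈⟨ ℙ.*-assoc g h (pow h k) ⟨
    mul (mul g h) (pow h k)    ∎))
    where open ≋-Reasoning

  X+⋯-mul-unit : ∀ {u k} → u 0 ≈ 1# → X+⋯ k → X+⋯ (mul u k)
  X+⋯-mul-unit {u} {k} u0 kX = record
    { coeff₀ = trans (mul-at-0 u k) (trans (*-congˡ (coeff₀ kX)) (zeroʳ _))
    ; coeff₁ = trans (mul-at-1 u k) (trans (+-cong (trans (*-cong u0 (coeff₁ kX)) (*-identityˡ 1#))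
                                                  (trans (*-congˡ (coeff₀ kX)) (zeroʳ _))) (+-identityʳ 1#)) }

  comp-X+⋯ : ∀ {g h} → X+⋯ g → X+⋯ h → X+⋯ (comp g h)
  comp-X+⋯ {g} {h} gX hX = record
    { coeff₀ = trans (comp-at-0 g h) (coeff₀ gX)
    ; coeff₁ = trans (comp-at-1 {h} (coeff₀ hX) g) (trans (*-cong (coeff₁ gX) (coeff₁ hX)) (*-identityˡ 1#)) }

  ∏-X+⋯ : ∀ {n} (v : Fin n → PS) → (∀ i → X+⋯ (v i)) → ∏ v ≋ mul (pow X n) (∏ (λ i → shift (v i)))
  ∏-X+⋯ {n} v vX = begin
    ∏ v                                          ≈⟨ ∏-cong {n} {v} (λ i → X+⋯-split (vX i)) ⟩
    ∏ (λ i → mul X (shift (v i)))                ≈⟨ ∏-distrib {n} (λ _ → X) (λ i → shift (v i)) ⟩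
    mul (∏ {n} (λ _ → X)) (∏ (λ i → shift (v i))) ≈⟨ ℙ.*-congʳ {∏ (λ i → shift (v i))} (∏-const n X) ⟩
    mul (pow X n) (∏ (λ i → shift (v i)))        ∎
    where open ≋-Reasoning

  div-mul-cancel : ∀ {f k} → f 0 ≈ 0# → X+⋯ k → mul (div f k) k ≋ f
  div-mul-cancel {f} {k} f0 kX = begin
    mul (mul (shift f) r) k                  ≈⟨ ℙ.*-congˡ {mul (shift f) r} (X+⋯-split kX) ⟩
    mul (mul (shift f) r) (mul X (shift k))  ≈⟨ rearrange (shift f) r X (shift k) ⟩
    mul X (mul (shift f) (mul r (shift k)))  ≈⟨ ℙ.*-congˡ {X} (ℙ.*-congˡ {shift f} (recip-inverseˡ (shift k) (coeff₁ kX))) ⟩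
    mul X (mul (shift f) one)                ≈⟨ ℙ.*-congˡ {X} (ℙ.*-identityʳ (shift f)) ⟩
    mul X (shift f)                          ≈⟨ X-mul-shift f f0 ⟩
    f                                        ∎
    where
    open ≋-Reasoning
    r = recip₁ (shift k)
    rearrange : ∀ a b x c → mul (mul a b) (mul x c) ≋ mul x (mul a (mul b c))
    rearrange = solve 4 (λ a b x c → (a :* b) :* (x :* c) := x :* (a :* (b :* c))) ℙ.refl
      where open ℙ-Solver

  div-unique : ∀ {f k q} → X+⋯ k → mul q k ≋ f → q ≋ div f k
  div-unique {f} {k} {q} kX qk≋f = X+⋯-cancelʳ kX (≋-trans qk≋f (≋-sym (div-mul-cancel f0 kX)))
    where
    f0 : f 0 ≈ 0#
    f0 = trans (sym (coeff qk≋f 0)) (trans (mul-at-0 q k) (trans (*-congˡ (coeff₀ kX)) (zeroʳ _)))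

  div-cong : ∀ {f f′ k k′} → f ≋ f′ → k ≋ k′ → X+⋯ k → div f k ≋ div f′ k′
  div-cong f≋f′ k≋k′ kX =
    mul-cong (mk≋ λ n → coeff f≋f′ (suc n)) (recip-cong (mk≋ λ n → coeff k≋k′ (suc n)) (coeff₁ kX))

  div-at-0 : ∀ f k → div f k 0 ≈ f 1
  div-at-0 f k = trans (mul-at-0 (shift f) (recip₁ (shift k))) (*-identityʳ _)

  comp-div : ∀ {h f k} → X+⋯ h → f 0 ≈ 0# → X+⋯ k → comp (div f k) h ≋ div (comp f h) (comp k h)
  comp-div {h} {f} {k} hX f0 kX = div-unique (comp-X+⋯ kX hX)
    (≋-trans (≋-sym (comp-mul (coeff₀ hX) (div f k) k)) (comp-cong (div-mul-cancel f0 kX) ≋-refl))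

  div-cross-mul : ∀ {e k b c} → e 0 ≈ 0# → X+⋯ k → mul e b ≋ mul k c → mul (div e k) b ≋ c
  div-cross-mul {e} {k} {b} {c} e0 kX eb≋kc = X+⋯-cancelʳ kX (begin
    mul (mul (div e k) b) k    ≈⟨ xy∙z≈xz∙y (div e k) b k ⟩
    mul (mul (div e k) k) b    ≈⟨ ℙ.*-congʳ {b} (div-mul-cancel e0 kX) ⟩
    mul e b                    ≈⟨ eb≋kc ⟩
    mul k c                    ≈⟨ mul-comm k c ⟩
    mul c k                    ∎)
    where
    open ≋-Reasoning
    open CommutativeSemigroupProperties ℙ.*-commutativeSemigroup using (xy∙z≈xz∙y)

  -- Fourth roots

  four : Carrier
  four = 1# + 1# + 1# + 1#

  quarter-inverse : quarter * four ≈ 1#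
  quarter-inverse = quarter-times-four 1#
    where
    quarter-times-four : ∀ x → quarter * (x + x + x + x) ≈ x
    quarter-times-four = solve 1 (λ x → con (ℤ.+ 1 ℚ./ 4) :* (x :+ x :+ x :+ x) := x) refl
      where open ℚ-Solver

  cubicSum : PS → PS → PS
  cubicSum u v = mul u (mul u u) ⊕ mul u (mul u v) ⊕ mul u (mul v v) ⊕ mul v (mul v v)

  mixedSum : PS → PS → PS
  mixedSum u v = mul u (mul u (mul u v)) ⊕ mul u (mul u (mul v v)) ⊕ mul u (mul v (mul v v))

  -- u⁴ − v⁴ = (u − v) · cubicSum u v, written without subtraction.
  mul-cubicSumˡ : ∀ u v → mul u (cubicSum u v) ≋ pow u 4 ⊕ mixedSum u v
  mul-cubicSumˡ = solve 2 (λ u v → u :* (u :* (u :* u) :+ u :* (u :* v) :+ u :* (v :* v) :+ v :* (v :* v))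
                                    := u :^ 4 :+ (u :* (u :* (u :* v)) :+ u :* (u :* (v :* v)) :+ u :* (v :* (v :* v)))) ℙ.refl
    where open ℙ-Solver

  mul-cubicSumʳ : ∀ u v → mul v (cubicSum u v) ≋ pow v 4 ⊕ mixedSum u v
  mul-cubicSumʳ = solve 2 (λ u v → v :* (u :* (u :* u) :+ u :* (u :* v) :+ u :* (v :* v) :+ v :* (v :* v))
                                    := v :^ 4 :+ (u :* (u :* (u :* v)) :+ u :* (u :* (v :* v)) :+ u :* (v :* (v :* v)))) ℙ.refl
    where open ℙ-Solver

  cubicSum-at-0 : ∀ u v → u 0 ≈ 1# → v 0 ≈ 1# → cubicSum u v 0 ≈ four
  cubicSum-at-0 u v u0 v0 = +-cong (+-cong (+-cong (cube u u u u0 u0 u0) (cube u u v u0 u0 v0))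
                                                (cube u v v u0 v0 v0)) (cube v v v v0 v0 v0)
    where
    cube : ∀ a b c → a 0 ≈ 1# → b 0 ≈ 1# → c 0 ≈ 1# → mul a (mul b c) 0 ≈ 1#
    cube a b c a0 b0 c0 = trans (mul-at-0 a (mul b c)) (trans (*-cong a0 (trans (mul-at-0 b c)
      (trans (*-cong b0 c0) (*-identityˡ 1#)))) (*-identityˡ 1#))

  unit-fourth-root-unique : ∀ {u v} → u 0 ≈ 1# → v 0 ≈ 1# → pow u 4 ≋ pow v 4 → u ≋ v
  unit-fourth-root-unique {u} {v} u0 v0 u⁴≋v⁴ = unit-cancelʳ {w} w0 (begin
    mul u (mul (C quarter) S)   ≈⟨ x∙yz≈y∙xz u (C quarter) S ⟩
    mul (C quarter) (mul u S)   ≈⟨ ℙ.*-congˡ {C quarter} uS≋vS ⟩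
    mul (C quarter) (mul v S)   ≈⟨ x∙yz≈y∙xz v (C quarter) S ⟨
    mul v (mul (C quarter) S)   ∎)
    where
    open ≋-Reasoning
    open CommutativeSemigroupProperties ℙ.*-commutativeSemigroup using (x∙yz≈y∙xz)
    S = cubicSum u v
    w = mul (C quarter) S
    w0 : w 0 ≈ 1#
    w0 = trans (mul-at-0 (C quarter) S) (trans (*-congˡ (cubicSum-at-0 u v u0 v0)) quarter-inverse)
    uS≋vS : mul u S ≋ mul v S
    uS≋vS = ≋-trans (mul-cubicSumˡ u v) (≋-trans (ℙ.+-congʳ u⁴≋v⁴) (≋-sym (mul-cubicSumʳ u v)))

  -- The recursion step local to root4, restated under a name (see shift-root4).
  root4-step : PS → ℕ → PS → Carrier
  root4-step q zero    v = 1#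
  root4-step q (suc m) v = quarter * (q (suc m) - pow v 4 (suc m))

  root4-step-cong : ∀ q m {v v′} → v ≋ v′ → root4-step q m v ≈ root4-step q m v′
  root4-step-cong q zero    v≋v′ = refl
  root4-step-cong q (suc m) v≋v′ = *-congˡ (+-congˡ (-‿cong (coeff (pow-cong 4 v≋v′) (suc m))))

  -- At index m + 1, u differs from its truncation V only in u (m + 1), which enters u⁴ with the
  -- factor cubicSum u V 0 = 4; the recursion chooses u (m + 1) to make up the difference to q.
  root4-step-pow : ∀ q → q 0 ≈ 1# → pow (seqRec (root4-step q)) 4 ≋ q
  root4-step-pow q q0 .coeff zero    = trans (pow-at-0 {seqRec (root4-step q)} refl 4) (sym q0)
  root4-step-pow q q0 .coeff (suc m) = +-cancelʳ (T (suc m)) _ _ (begin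
    pow u 4 (suc m) + T (suc m)
      ≈⟨ coeff (mul-cubicSumˡ u V) (suc m) ⟨
    mul u S (suc m)
      ≈⟨ mul-at-top S (prefix-agree step (suc m)) (reflexive (prefix-above step {suc m} ℕ.≤-refl)) ⟩
    mul V S (suc m) + u (suc m) * S 0
      ≈⟨ +-cong (coeff (mul-cubicSumʳ u V) (suc m))
                (*-congˡ (cubicSum-at-0 u V refl (below (prefix-agree step (suc m)) 0 (s≤s z≤n)))) ⟩
    (pow V 4 (suc m) + T (suc m)) + (quarter * (q (suc m) - pow V 4 (suc m))) * four
      ≈⟨ +-congˡ (times-quarter-four (q (suc m) - pow V 4 (suc m))) ⟩
    (pow V 4 (suc m) + T (suc m)) + (q (suc m) - pow V 4 (suc m))
      ≈⟨ cancel (pow V 4 (suc m)) (T (suc m)) (q (suc m)) ⟩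
    q (suc m) + T (suc m)
      ∎)
    where
    open ≈R
    step = root4-step q
    u = seqRec step
    V = prefix step (suc m)
    S = cubicSum u V
    T = mixedSum u V
    times-quarter-four : ∀ d → (quarter * d) * four ≈ d
    times-quarter-four d = trans (*-congʳ (*-comm quarter d))
      (trans (*-assoc d quarter four) (trans (*-congˡ quarter-inverse) (*-identityʳ d)))
    cancel : ∀ a t b → (a + t) + (b - a) ≈ b + t
    cancel = solve 3 (λ a t b → (a :+ t) :+ (b :- a) := b :+ t) refl
      where open ℚ-Solver

  shift-root4 : ∀ p → shift (root4 p) ≋ seqRec (root4-step (λ m → p (4 +ℕ m)))
  shift-root4 p .coeff zero    = refl
  shift-root4 p .coeff (suc m) = root4-step-cong q (suc m)
    (prefix-cong (λ { zero _ → refl ; (suc _) _ → refl }) (root4-step-cong q) (suc m))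
    where
    q : PS
    q m = p (4 +ℕ m)

  pow4-X+⋯ : ∀ {h} → X+⋯ h → pow h 4 ≋ mul (pow X 4) (pow (shift h) 4)
  pow4-X+⋯ {h} hX = ≋-trans (pow-cong 4 (X+⋯-split hX)) (∏-distrib {4} (λ _ → X) (λ _ → shift h))

  root4-X+⋯ : ∀ p → X+⋯ (root4 p)
  root4-X+⋯ p = record { coeff₀ = refl ; coeff₁ = refl }

  root4-pow : ∀ p P → p ≋ mul (pow X 4) P → P 0 ≈ 1# → pow (root4 p) 4 ≋ p
  root4-pow p P p≋X⁴P P0 = begin
    pow (root4 p) 4                             ≈⟨ pow4-X+⋯ (root4-X+⋯ p) ⟩
    mul (pow X 4) (pow (shift (root4 p)) 4)     ≈⟨ ℙ.*-congˡ {pow X 4} (≋-trans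
                                                     (≋-trans (pow-cong 4 (shift-root4 p))
                                                       (root4-step-pow q (trans (coeff q≋P 0) P0)))
                                                     q≋P) ⟩
    mul (pow X 4) P                             ≈⟨ p≋X⁴P ⟨
    p                                           ∎
    where
    open ≋-Reasoning
    q : PS
    q m = p (4 +ℕ m)
    q≋P : q ≋ P
    q≋P .coeff m = trans (coeff p≋X⁴P (4 +ℕ m)) (mul-pow-X-at 4 P m)

  fourth-root-unique : ∀ {a b} → X+⋯ a → X+⋯ b → pow a 4 ≋ pow b 4 → a ≋ b
  fourth-root-unique {a} {b} aX bX a⁴≋b⁴ = begin
    a                  ≈⟨ X+⋯-split aX ⟩
    mul X (shift a)    ≈⟨ ℙ.*-congˡ {X} (unit-fourth-root-unique (coeff₁ aX) (coeff₁ bX) (pow-X-cancel 4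
                            (≋-trans (≋-sym (pow4-X+⋯ aX)) (≋-trans a⁴≋b⁴ (pow4-X+⋯ bX))))) ⟩
    mul X (shift b)    ≈⟨ X+⋯-split bX ⟨
    b                  ∎
    where open ≋-Reasoning

  record IsFourthRoot (p h : PS) : Set ℓ where
    field
      x+⋯  : X+⋯ h
      pow4 : pow h 4 ≋ p
  open IsFourthRoot public

  IsFourthRoot-unique : ∀ {p p′ h h′} → IsFourthRoot p h → IsFourthRoot p′ h′ → p ≋ p′ → h ≋ h′
  IsFourthRoot-unique hR h′R p≋p′ =
    fourth-root-unique (x+⋯ hR) (x+⋯ h′R) (≋-trans (pow4 hR) (≋-trans p≋p′ (≋-sym (pow4 h′R))))

  product4 : (Fin 4 → PS) → PS
  product4 v = mul (v Fin.zero) (mul (v (Fin.suc Fin.zero))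
                 (mul (v (Fin.suc (Fin.suc Fin.zero))) (v (Fin.suc (Fin.suc (Fin.suc Fin.zero))))))

  product4≋∏ : ∀ v → product4 v ≋ ∏ v
  product4≋∏ v = ℙ.*-congˡ (ℙ.*-congˡ (ℙ.*-congˡ (ℙ.sym (ℙ.*-identityʳ _))))

  root4-product4 : ∀ v → (∀ i → X+⋯ (v i)) → IsFourthRoot (∏ v) (root4 (product4 v))
  root4-product4 v vX = record
    { x+⋯  = root4-X+⋯ (product4 v)
    ; pow4 = ≋-trans (root4-pow (product4 v) (∏ (λ i → shift (v i)))
                        (≋-trans (product4≋∏ v) (∏-X+⋯ v vX)) (∏-at-0 (λ i → shift (v i)) (λ i → coeff₁ (vX i))))
                     (product4≋∏ v) }

  -- Compositional inverses

  compInv-at-suc : ∀ h n →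
    compInv h (suc n) ≈ δ₀ n - Σ< n (λ j → h (2 +ℕ j) * pow (compInv h) (2 +ℕ j) (suc n))
  compInv-at-suc h n = +-congˡ (-‿cong (Σ-cong n (λ j _ → *-congˡ
    (pow-agree-suc (below (prefix-agree _ (suc n)) 0 (s≤s z≤n)) refl (prefix-agree _ (suc n)) j))))

  X+⋯-compInv : ∀ h → X+⋯ (compInv h)
  X+⋯-compInv h = record { coeff₀ = refl ; coeff₁ = trans (+-congˡ -0#≈0#) (+-identityʳ _) }

  comp-compInv : ∀ {h} → X+⋯ h → comp h (compInv h) ≋ X
  comp-compInv {h} hX .coeff zero    = trans (comp-at-0 h (compInv h)) (coeff₀ hX)
  comp-compInv {h} hX .coeff (suc n) = begin
    comp h h̄ (suc n)
      ≈⟨ Σ-front (suc n) F ⟩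
    F 0 + Σ< (suc n) (λ k → F (suc k))
      ≈⟨ +-cong (trans (*-congʳ (coeff₀ hX)) (zeroˡ _)) (Σ-front n (λ k → F (suc k))) ⟩
    0# + (F 1 + Σ< n (λ j → F (2 +ℕ j)))
      ≈⟨ +-identityˡ _ ⟩
    F 1 + Σ< n (λ j → F (2 +ℕ j))
      ≈⟨ +-congʳ (trans (*-cong (coeff₁ hX) (coeff (ℙ.*-identityʳ h̄) (suc n)))
                        (trans (*-identityˡ _) (compInv-at-suc h n))) ⟩
    (δ₀ n - Σ< n (λ j → F (2 +ℕ j))) + Σ< n (λ j → F (2 +ℕ j))
      ≈⟨ minus-plus _ _ ⟩
    δ₀ n
      ≈⟨ δ₀≈X n ⟩
    X (suc n)
      ∎
    where
    open ≈R
    h̄ = compInv h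
    F = λ k → h k * pow h̄ k (suc n)
    minus-plus : ∀ d s → (d - s) + s ≈ d
    minus-plus = solve 2 (λ d s → (d :- s) :+ s := d) refl
      where open ℚ-Solver
    δ₀≈X : ∀ n → δ₀ n ≈ X (suc n)
    δ₀≈X zero    = refl
    δ₀≈X (suc n) = refl

  -- h̄ = compInv h has a right inverse of its own, and associativity forces it to be h.
  compInv-comp : ∀ {h} → X+⋯ h → comp (compInv h) h ≋ X
  compInv-comp {h} hX = ≋-trans (comp-cong ≋-refl h≋h̿) (comp-compInv (X+⋯-compInv h))
    where
    open ≋-Reasoning
    h̄ = compInv h
    h̿ = compInv h̄
    h≋h̿ : h ≋ h̿
    h≋h̿ = begin
      h                     ≈⟨ comp-X-right h ⟨
      comp h X              ≈⟨ comp-cong ≋-refl (comp-compInv (X+⋯-compInv h)) ⟨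
      comp h (comp h̄ h̿)     ≈⟨ comp-assoc refl refl h ⟨
      comp (comp h h̄) h̿     ≈⟨ comp-cong (comp-compInv hX) ≋-refl ⟩
      comp X h̿              ≈⟨ comp-X-left {h̿} refl ⟩
      h̿                     ∎

  compInv-unique : ∀ {h t} → X+⋯ h → t 0 ≈ 0# → comp h t ≋ X → t ≋ compInv h
  compInv-unique {h} {t} hX t0 ht≋X = begin
    t                      ≈⟨ comp-X-left t0 ⟨
    comp X t               ≈⟨ comp-cong (compInv-comp hX) ≋-refl ⟨
    comp (comp h̄ h) t      ≈⟨ comp-assoc (coeff₀ hX) t0 h̄ ⟩
    comp h̄ (comp h t)      ≈⟨ comp-cong ≋-refl ht≋X ⟩
    comp h̄ X               ≈⟨ comp-X-right h̄ ⟩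
    h̄                      ∎
    where
    open ≋-Reasoning
    h̄ = compInv h

  compInv-cong : ∀ {h h′} → h ≋ h′ → X+⋯ h → compInv h ≋ compInv h′
  compInv-cong {h} {h′} h≋h′ hX = compInv-unique (X+⋯-≋ h≋h′ hX) refl
    (≋-trans (comp-cong (≋-sym h≋h′) ≋-refl) (comp-compInv hX))

  comp-compInv-cancel : ∀ {h} → X+⋯ h → ∀ g → comp (comp g (compInv h)) h ≋ g
  comp-compInv-cancel {h} hX g = ≋-trans (comp-assoc refl (coeff₀ hX) g)
    (≋-trans (comp-cong ≋-refl (compInv-comp hX)) (comp-X-right g))

  -- Homogeneity with respect to exponents modulo 4

  %4-cong-+ : ∀ {a b c d} → a % 4 ≡ b % 4 → c % 4 ≡ d % 4 → (a +ℕ c) % 4 ≡ (b +ℕ d) % 4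
  %4-cong-+ {a} {b} {c} {d} a≡b c≡d = begin
    (a +ℕ c) % 4               ≡⟨ %-distribˡ-+ a c 4 ⟩
    (a % 4 +ℕ c % 4) % 4       ≡⟨ ≡.cong₂ (λ x y → (x +ℕ y) % 4) a≡b c≡d ⟩
    (b % 4 +ℕ d % 4) % 4       ≡⟨ %-distribˡ-+ b d 4 ⟨
    (b +ℕ d) % 4               ∎
    where open ≡.≡-Reasoning

  %4-cancel-suc : ∀ {n r} → suc n % 4 ≡ suc r % 4 → n % 4 ≡ r % 4
  %4-cancel-suc {n} {r} e = begin
    n % 4               ≡⟨ [m+n]%n≡m%n n 4 ⟨
    (n +ℕ 4) % 4        ≡⟨ ≡.cong (_% 4) (ℕ.+-suc n 3) ⟩
    (suc n +ℕ 3) % 4    ≡⟨ %4-cong-+ {suc n} {suc r} {3} {3} e ≡.refl ⟩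
    (suc r +ℕ 3) % 4    ≡⟨ ≡.cong (_% 4) (ℕ.+-suc r 3) ⟨
    (r +ℕ 4) % 4        ≡⟨ [m+n]%n≡m%n r 4 ⟩
    r % 4               ∎
    where open ≡.≡-Reasoning

  -- Only exponents ≡ r (mod 4) occur: R[[x⁴]] is Homogeneous 0 and xR[[x⁴]] is Homogeneous 1.
  record Homogeneous (r : ℕ) (s : PS) : Set ℓ where
    constructor homogeneous
    field vanishes : ∀ n → n % 4 ≢ r % 4 → s n ≈ 0#
  open Homogeneous public

  Homogeneous-≋ : ∀ {r f g} → f ≋ g → Homogeneous r f → Homogeneous r g
  Homogeneous-≋ f≋g fH .vanishes n n≢r = trans (sym (coeff f≋g n)) (vanishes fH n n≢r)

  Homogeneous-residue : ∀ {r r′ f} → r % 4 ≡ r′ % 4 → Homogeneous r f → Homogeneous r′ f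
  Homogeneous-residue r≡r′ fH .vanishes n n≢r′ = vanishes fH n (λ n≡r → n≢r′ (≡.trans n≡r r≡r′))

  product-vanishes : ∀ {a b : PS} {x y r r′} → (x % 4 ≢ r % 4 → a x ≈ 0#) → (y % 4 ≢ r′ % 4 → b y ≈ 0#) →
                     (x +ℕ y) % 4 ≢ (r +ℕ r′) % 4 → a x * b y ≈ 0#
  product-vanishes {x = x} {y} {r} {r′} ax by x+y≢r+r′ with x % 4 ℕ.≟ r % 4
  ... | no  x≢r = trans (*-congʳ (ax x≢r)) (zeroˡ _)
  ... | yes x≡r = trans (*-congˡ (by (λ y≡r′ → x+y≢r+r′ (%4-cong-+ {x} {r} {y} {r′} x≡r y≡r′)))) (zeroʳ _)

  Homogeneous-mul : ∀ {r r′ f g} → Homogeneous r f → Homogeneous r′ g → Homogeneous (r +ℕ r′) (mul f g)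
  Homogeneous-mul {r} {r′} {f} {g} fH gH .vanishes n n≢r+r′ = Σ-zero (suc n) λ k k≤n →
    product-vanishes {f} {g} {k} {n ∸ k} {r} {r′} (vanishes fH k) (vanishes gH (n ∸ k))
      (λ e → n≢r+r′ (≡.trans (≡.cong (_% 4) (≡.sym (ℕ.m+[n∸m]≡n (ℕ.≤-pred k≤n)))) e))

  Homogeneous-one : Homogeneous 0 one
  Homogeneous-one .vanishes zero    0≢0 = ⊥-elim (0≢0 ≡.refl)
  Homogeneous-one .vanishes (suc n) _   = refl

  Homogeneous-X : Homogeneous 1 X
  Homogeneous-X .vanishes zero          _   = refl
  Homogeneous-X .vanishes (suc zero)    1≢1 = ⊥-elim (1≢1 ≡.refl)
  Homogeneous-X .vanishes (suc (suc n)) _   = refl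

  Homogeneous-pow : ∀ {r f} → Homogeneous r f → ∀ k → Homogeneous (k *ℕ r) (pow f k)
  Homogeneous-pow fH zero    = Homogeneous-one
  Homogeneous-pow fH (suc k) = Homogeneous-mul fH (Homogeneous-pow fH k)

  Homogeneous-shift : ∀ {r f} → Homogeneous (suc r) f → Homogeneous r (shift f)
  Homogeneous-shift {r} fH .vanishes n n≢r = vanishes fH (suc n) (λ e → n≢r (%4-cancel-suc {n} {r} e))

  comp-term-vanishes : ∀ {r g h n} → Homogeneous r g → Homogeneous 1 h → n % 4 ≢ r % 4 →
                       ∀ k → g k * pow h k n ≈ 0#
  comp-term-vanishes {r} {g} {h} {n} gH hH n≢r k with k % 4 ℕ.≟ r % 4
  ... | no  k≢r = trans (*-congʳ (vanishes gH k k≢r)) (zeroˡ _)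
  ... | yes k≡r = trans (*-congˡ (vanishes hᵏH n (λ n≡k → n≢r (≡.trans n≡k k≡r)))) (zeroʳ _)
    where
    hᵏH : Homogeneous k (pow h k)
    hᵏH = Homogeneous-residue (≡.cong (_% 4) (ℕ.*-identityʳ k)) (Homogeneous-pow hH k)

  Homogeneous-comp : ∀ {r g h} → Homogeneous r g → Homogeneous 1 h → Homogeneous r (comp g h)
  Homogeneous-comp gH hH .vanishes n n≢r = Σ-zero (suc n) (λ k _ → comp-term-vanishes gH hH n≢r k)

  Homogeneous-prefix : ∀ {r} step n → (∀ {i} → i < n → i % 4 ≢ r % 4 → seqRec step i ≈ 0#) →
                       Homogeneous r (prefix step n)
  Homogeneous-prefix step n below-n .vanishes i i≢r with i ℕ.<? n
  ... | yes i<n = trans (reflexive (prefix-below step i<n)) (below-n i<n i≢r)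
  ... | no  i≮n = reflexive (prefix-above step (ℕ.≮⇒≥ i≮n))

  Homogeneous-recip : ∀ {g} → Homogeneous 0 g → Homogeneous 0 (recip₁ g)
  Homogeneous-recip {g} gH .vanishes = <-rec P step
    where
    P : ℕ → Set ℓ
    P n = n % 4 ≢ 0 → recip₁ g n ≈ 0#
    step : ∀ n → (∀ {i} → i < n → P i) → P n
    step zero    IH 0≢0 = ⊥-elim (0≢0 ≡.refl)
    step (suc m) IH n≢0 = trans (recip-at-suc g m) (trans (-‿cong (Σ-zero (suc m) term)) -0#≈0#)
      where
      term : ∀ k → k < suc m → g (suc m ∸ k) * recip₁ g k ≈ 0#
      term k k<1+m = product-vanishes {g} {recip₁ g} {suc m ∸ k} {k} {0} {0} (vanishes gH (suc m ∸ k)) (IH k<1+m)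
        (λ e → n≢0 (≡.trans (≡.cong (_% 4) (≡.sym (ℕ.m∸n+n≡m (ℕ.<⇒≤ k<1+m)))) e))

  Homogeneous-root4-step : ∀ {q} → Homogeneous 0 q → Homogeneous 0 (seqRec (root4-step q))
  Homogeneous-root4-step {q} qH .vanishes = <-rec P step
    where
    P : ℕ → Set ℓ
    P n = n % 4 ≢ 0 → seqRec (root4-step q) n ≈ 0#
    step : ∀ n → (∀ {i} → i < n → P i) → P n
    step zero    IH 0≢0 = ⊥-elim (0≢0 ≡.refl)
    step (suc m) IH n≢0 = trans (*-congˡ (trans
      (+-cong (vanishes qH (suc m) n≢0) (-‿cong (vanishes (Homogeneous-pow VH 4) (suc m) n≢0)))
      (trans (+-identityˡ _) -0#≈0#))) (zeroʳ _)
      where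
      VH : Homogeneous 0 (prefix (root4-step q) (suc m))
      VH = Homogeneous-prefix (root4-step q) (suc m) IH

  Homogeneous-root4 : ∀ {p} → Homogeneous 0 p → Homogeneous 1 (root4 p)
  Homogeneous-root4 {p} pH = Homogeneous-≋ (≋-sym (≋-trans (X+⋯-split (root4-X+⋯ p)) (ℙ.*-congˡ {X} (shift-root4 p))))
    (Homogeneous-mul Homogeneous-X (Homogeneous-root4-step (shift⁴-homogeneous)))
    where
    shift⁴-homogeneous : Homogeneous 0 (λ m → p (4 +ℕ m))
    shift⁴-homogeneous = Homogeneous-shift (Homogeneous-shift (Homogeneous-shift (Homogeneous-shift {3}
                           (Homogeneous-residue {0} {4} ≡.refl pH))))

  Homogeneous-compInv : ∀ {h} → Homogeneous 1 h → Homogeneous 1 (compInv h)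
  Homogeneous-compInv {h} hH .vanishes = <-rec P step
    where
    P : ℕ → Set ℓ
    P n = n % 4 ≢ 1 → compInv h n ≈ 0#
    step : ∀ n → (∀ {i} → i < n → P i) → P n
    step zero          IH _   = refl
    step (suc zero)    IH 1≢1 = ⊥-elim (1≢1 ≡.refl)
    step (suc (suc m)) IH n≢1 = trans (+-congˡ (-‿cong (Σ-zero (suc m) (λ j _ →
      comp-term-vanishes {n = 2 +ℕ m} hH (Homogeneous-prefix _ (2 +ℕ m) IH) n≢1 (2 +ℕ j)))))
      (trans (+-identityˡ _) -0#≈0#)

  Homogeneous-div : ∀ {r f k} → Homogeneous (suc r) f → Homogeneous 1 k → Homogeneous r (div f k)
  Homogeneous-div {r} fH kH = Homogeneous-residue (≡.cong (_% 4) (ℕ.+-identityʳ r))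
    (Homogeneous-mul (Homogeneous-shift fH) (Homogeneous-recip (Homogeneous-shift kH)))

  -- The quadruple Riordan group

  -- InQ and _≈Q_ repackaged as records, for the same reason as _≋_.
  record Member (a : Tuple) : Set ℓ where
    field
      g-homogeneous : Homogeneous 0 (g a)
      g-at-0        : g a 0 ≈ 1#
      f-homogeneous : ∀ i → Homogeneous 1 (f a i)
      f-X+⋯         : ∀ i → X+⋯ (f a i)
  open Member public

  InQ⇒Member : ∀ {a} → InQ a → Member a
  InQ⇒Member (gH , g0 , fH) = record
    { g-homogeneous = homogeneous gH
    ; g-at-0        = g0
    ; f-homogeneous = λ i → homogeneous (proj₁ (fH i))
    ; f-X+⋯         = λ i → record { coeff₀ = proj₁ (fH i) 0 (λ ()) ; coeff₁ = proj₂ (fH i) } }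

  Member⇒InQ : ∀ {a} → Member a → InQ a
  Member⇒InQ aQ = vanishes (g-homogeneous aQ) , g-at-0 aQ , λ i → vanishes (f-homogeneous aQ i) , coeff₁ (f-X+⋯ aQ i)

  infix 4 _≋Q_
  record _≋Q_ (a b : Tuple) : Set ℓ where
    field
      g≋ : g a ≋ g b
      f≋ : ∀ i → f a i ≋ f b i
  open _≋Q_ public

  ≈Q⇒≋Q : ∀ {a b} → a ≈Q b → a ≋Q b
  ≈Q⇒≋Q (g≈ , f≈) = record { g≋ = mk≋ g≈ ; f≋ = λ i → mk≋ (f≈ i) }

  ≋Q⇒≈Q : ∀ {a b} → a ≋Q b → a ≈Q b
  ≋Q⇒≈Q a≋b = coeff (g≋ a≋b) , λ i → coeff (f≋ a≋b i)

  fOverH : Tuple → Fin 4 → PS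
  fOverH a i = div (f a i) (hOf a)

  h-root : ∀ {a} → Member a → IsFourthRoot (∏ (f a)) (hOf a)
  h-root {a} aQ = root4-product4 (f a) (f-X+⋯ aQ)

  h-X+⋯ : ∀ {a} → Member a → X+⋯ (hOf a)
  h-X+⋯ aQ = x+⋯ (h-root aQ)

  h-homogeneous : ∀ {a} → Member a → Homogeneous 1 (hOf a)
  h-homogeneous aQ = Homogeneous-root4 (Homogeneous-residue {4} {0} ≡.refl
    (Homogeneous-mul (f-homogeneous aQ _) (Homogeneous-mul (f-homogeneous aQ _)
      (Homogeneous-mul (f-homogeneous aQ _) (f-homogeneous aQ _)))))

  fOverH-mul-h : ∀ {a} → Member a → ∀ i → mul (fOverH a i) (hOf a) ≋ f a i
  fOverH-mul-h aQ i = div-mul-cancel (coeff₀ (f-X+⋯ aQ i)) (h-X+⋯ aQ)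

  ∏-fOverH : ∀ {a} → Member a → ∏ (fOverH a) ≋ one
  ∏-fOverH {a} aQ = X+⋯-pow-cancelʳ (h-X+⋯ aQ) 4 (begin
    mul (∏ (fOverH a)) (pow (hOf a) 4)      ≈⟨ ∏-distrib (fOverH a) (λ _ → hOf a) ⟨
    ∏ (λ i → mul (fOverH a i) (hOf a))      ≈⟨ ∏-cong {4} (fOverH-mul-h aQ) ⟩
    ∏ (f a)                                 ≈⟨ pow4 (h-root aQ) ⟨
    pow (hOf a) 4                           ≈⟨ ℙ.*-identityˡ (pow (hOf a) 4) ⟨
    mul one (pow (hOf a) 4)                 ∎)
    where open ≋-Reasoning

  ·-closed : ∀ {a b} → Member a → Member b → Member (a ·Q b)
  ·-closed {a} {b} aQ bQ = record
    { g-homogeneous = Homogeneous-mul (g-homogeneous aQ) (Homogeneous-comp (g-homogeneous bQ) (h-homogeneous aQ))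
    ; g-at-0        = trans (mul-at-0 (g a) (comp (g b) (hOf a)))
        (trans (*-cong (g-at-0 aQ) (trans (comp-at-0 (g b) (hOf a)) (g-at-0 bQ))) (*-identityˡ 1#))
    ; f-homogeneous = λ i → Homogeneous-mul (Homogeneous-div {0} (f-homogeneous aQ i) (h-homogeneous aQ))
                                            (Homogeneous-comp (f-homogeneous bQ i) (h-homogeneous aQ))
    ; f-X+⋯         = λ i → X+⋯-mul-unit (trans (div-at-0 (f a i) (hOf a)) (coeff₁ (f-X+⋯ aQ i)))
                                         (comp-X+⋯ (f-X+⋯ bQ i) (h-X+⋯ aQ)) }

  e-closed : Member eQ
  e-closed = record
    { g-homogeneous = Homogeneous-one ; g-at-0 = refl ; f-homogeneous = λ _ → Homogeneous-X ; f-X+⋯ = λ _ → X+⋯-X }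

  inv-closed : ∀ {a} → Member a → Member (invQ a)
  inv-closed {a} aQ = record
    { g-homogeneous = Homogeneous-recip (Homogeneous-comp (g-homogeneous aQ) h̄H)
    ; g-at-0        = refl
    ; f-homogeneous = λ i → Homogeneous-div {1} (Homogeneous-mul Homogeneous-X h̄H) (Homogeneous-comp (f-homogeneous aQ i) h̄H)
    ; f-X+⋯         = λ i → X+⋯-≋ (mul-comm (recip₁ (shift (comp (f a i) h̄))) (shift (mul X h̄)))
                                  (X+⋯-mul-unit refl (X+⋯-≋ (≋-sym shift-Xh̄) (X+⋯-compInv (hOf a)))) }
    where
    h̄ = compInv (hOf a)
    h̄H : Homogeneous 1 h̄
    h̄H = Homogeneous-compInv (h-homogeneous aQ)
    shift-Xh̄ : shift (mul X h̄) ≋ h̄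
    shift-Xh̄ .coeff n = mul-X-at-suc h̄ n

  hOf-cong : ∀ {a a′} → Member a → Member a′ → a ≋Q a′ → hOf a ≋ hOf a′
  hOf-cong aQ a′Q a≋a′ = IsFourthRoot-unique (h-root aQ) (h-root a′Q) (∏-cong {4} (f≋ a≋a′))

  hOf-eQ : hOf eQ ≋ X
  hOf-eQ = IsFourthRoot-unique (h-root {eQ} e-closed) (record { x+⋯ = X+⋯-X ; pow4 = ≋-refl }) ≋-refl

  hOf-· : ∀ {a b} → Member a → Member b → hOf (a ·Q b) ≋ comp (hOf b) (hOf a)
  hOf-· {a} {b} aQ bQ = IsFourthRoot-unique (h-root {a ·Q b} (·-closed aQ bQ)) root ≋-refl
    where
    open ≋-Reasoning
    h = hOf a
    H = hOf b
    h0 = coeff₀ (h-X+⋯ aQ)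
    root : IsFourthRoot (∏ (f (a ·Q b))) (comp H h)
    root .x+⋯  = comp-X+⋯ (h-X+⋯ bQ) (h-X+⋯ aQ)
    root .pow4 = begin
      pow (comp H h) 4                                    ≈⟨ comp-pow {h} h0 H 4 ⟨
      comp (pow H 4) h                                    ≈⟨ comp-cong (pow4 (h-root bQ)) (≋-refl {h}) ⟩
      comp (∏ (f b)) h                                    ≈⟨ comp-∏ {h} h0 (f b) ⟩
      ∏ (λ i → comp (f b i) h)                            ≈⟨ ℙ.*-identityˡ (∏ (λ i → comp (f b i) h)) ⟨
      mul one (∏ (λ i → comp (f b i) h))                  ≈⟨ ℙ.*-congʳ {∏ (λ i → comp (f b i) h)} (∏-fOverH aQ) ⟨
      mul (∏ (fOverH a)) (∏ (λ i → comp (f b i) h))       ≈⟨ ∏-distrib (fOverH a) (λ i → comp (f b i) h) ⟨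
      ∏ (λ i → mul (fOverH a i) (comp (f b i) h))         ∎

  hOf-invQ : ∀ {a} → Member a → hOf (invQ a) ≋ compInv (hOf a)
  hOf-invQ {a} aQ = IsFourthRoot-unique (h-root {invQ a} (inv-closed aQ)) root ≋-refl
    where
    open ≋-Reasoning
    h = hOf a
    h̄ = compInv h
    h̄X = X+⋯-compInv h
    B : Fin 4 → PS
    B i = comp (f a i) h̄
    X⁴≋∏B : pow X 4 ≋ ∏ B
    X⁴≋∏B = begin
      pow X 4               ≈⟨ pow-cong 4 (comp-compInv (h-X+⋯ aQ)) ⟨
      pow (comp h h̄) 4      ≈⟨ comp-pow {h̄} (coeff₀ h̄X) h 4 ⟨
      comp (pow h 4) h̄      ≈⟨ comp-cong (pow4 (h-root aQ)) (≋-refl {h̄}) ⟩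
      comp (∏ (f a)) h̄      ≈⟨ comp-∏ {h̄} (coeff₀ h̄X) (f a) ⟩
      ∏ B                   ∎
    ∏f⁻X⁴≋h̄⁴X⁴ : mul (∏ (f (invQ a))) (pow X 4) ≋ mul (pow h̄ 4) (pow X 4)
    ∏f⁻X⁴≋h̄⁴X⁴ = begin
      mul (∏ (f (invQ a))) (pow X 4)              ≈⟨ ℙ.*-congˡ {∏ (f (invQ a))} X⁴≋∏B ⟩
      mul (∏ (f (invQ a))) (∏ B)                  ≈⟨ ∏-distrib (f (invQ a)) B ⟨
      ∏ (λ i → mul (f (invQ a) i) (B i))          ≈⟨ ∏-cong {4} (λ i → div-mul-cancel {mul X h̄} {B i} (mul-X-at-0 h̄)
                                                        (comp-X+⋯ (f-X+⋯ aQ i) h̄X)) ⟩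
      ∏ {4} (λ _ → mul X h̄)                       ≈⟨ ∏-distrib {4} (λ _ → X) (λ _ → h̄) ⟩
      mul (pow X 4) (pow h̄ 4)                     ≈⟨ mul-comm (pow X 4) (pow h̄ 4) ⟩
      mul (pow h̄ 4) (pow X 4)                     ∎
    root : IsFourthRoot (∏ (f (invQ a))) h̄
    root .x+⋯  = h̄X
    root .pow4 = ≋-sym (X+⋯-pow-cancelʳ X+⋯-X 4 ∏f⁻X⁴≋h̄⁴X⁴)

  fOverH-· : ∀ {a b} → Member a → Member b → ∀ i →
             fOverH (a ·Q b) i ≋ mul (fOverH a i) (comp (fOverH b i) (hOf a))
  fOverH-· {a} {b} aQ bQ i = ≋-trans replace-h (≋-sym (div-unique (comp-X+⋯ (h-X+⋯ bQ) (h-X+⋯ aQ)) (begin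
    mul (mul D (comp E h)) (comp H h)   ≈⟨ ℙ.*-assoc D (comp E h) (comp H h) ⟩
    mul D (mul (comp E h) (comp H h))   ≈⟨ ℙ.*-congˡ {D} (comp-mul {h} (coeff₀ (h-X+⋯ aQ)) E H) ⟨
    mul D (comp (mul E H) h)            ≈⟨ ℙ.*-congˡ {D} (comp-cong (fOverH-mul-h bQ i) (≋-refl {h})) ⟩
    mul D (comp (f b i) h)              ∎)))
    where
    open ≋-Reasoning
    h = hOf a
    H = hOf b
    D = fOverH a i
    E = fOverH b i
    replace-h : fOverH (a ·Q b) i ≋ div (mul D (comp (f b i) h)) (comp H h)
    replace-h = div-cong {f (a ·Q b) i} {f (a ·Q b) i} {hOf (a ·Q b)} {comp H h}
                  ≋-refl (hOf-· {a} {b} aQ bQ) (h-X+⋯ {a ·Q b} (·-closed aQ bQ))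

  ·-cong : ∀ {a a′ b b′} → Member a → Member a′ → Member b → Member b′ → a ≋Q a′ → b ≋Q b′ → (a ·Q b) ≋Q (a′ ·Q b′)
  ·-cong aQ a′Q _ _ a≋a′ b≋b′ = record
    { g≋ = mul-cong (g≋ a≋a′) (comp-cong (g≋ b≋b′) h≋h′)
    ; f≋ = λ i → mul-cong (div-cong (f≋ a≋a′ i) h≋h′ (h-X+⋯ aQ)) (comp-cong (f≋ b≋b′ i) h≋h′) }
    where
    h≋h′ = hOf-cong aQ a′Q a≋a′

  inv-cong : ∀ {a a′} → Member a → Member a′ → a ≋Q a′ → invQ a ≋Q invQ a′
  inv-cong {a} aQ a′Q a≋a′ = record
    { g≋ = recip-cong (comp-cong (g≋ a≋a′) h̄≋h̄′) (trans (comp-at-0 (g a) h̄) (g-at-0 aQ))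
    ; f≋ = λ i → div-cong (ℙ.*-congˡ {X} h̄≋h̄′) (comp-cong (f≋ a≋a′ i) h̄≋h̄′) (comp-X+⋯ (f-X+⋯ aQ i) (X+⋯-compInv (hOf a))) }
    where
    h̄ = compInv (hOf a)
    h̄≋h̄′ = compInv-cong (hOf-cong aQ a′Q a≋a′) (h-X+⋯ aQ)

  ·-assoc : ∀ {a b c} → Member a → Member b → Member c → ((a ·Q b) ·Q c) ≋Q (a ·Q (b ·Q c))
  ·-assoc {a} {b} {c} aQ bQ cQ = record
    { g≋ = ≋-trans (ℙ.*-congˡ {g (a ·Q b)} (comp-cong (≋-refl {g c}) hab≋Hh))
                   (twisted-assoc {h} {H} h0 H0 (g a) (g b) (g c))
    ; f≋ = λ i → ≋-trans (mul-cong (fOverH-· aQ bQ i) (comp-cong (≋-refl {f c i}) hab≋Hh))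
                         (twisted-assoc {h} {H} h0 H0 (fOverH a i) (fOverH b i) (f c i)) }
    where
    h = hOf a
    H = hOf b
    h0 = coeff₀ (h-X+⋯ aQ)
    H0 = coeff₀ (h-X+⋯ bQ)
    hab≋Hh : hOf (a ·Q b) ≋ comp H h
    hab≋Hh = hOf-· {a} {b} aQ bQ

  ·-identityʳ : ∀ {a} → Member a → (a ·Q eQ) ≋Q a
  ·-identityʳ {a} aQ = record
    { g≋ = ≋-trans (ℙ.*-congˡ {g a} (comp-one (hOf a))) (ℙ.*-identityʳ (g a))
    ; f≋ = λ i → ≋-trans (ℙ.*-congˡ {fOverH a i} (comp-X-left {hOf a} (coeff₀ (h-X+⋯ aQ)))) (fOverH-mul-h aQ i) }

  ·-identityˡ : ∀ {a} → Member a → (eQ ·Q a) ≋Q a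
  ·-identityˡ {a} aQ = record
    { g≋ = ≋-trans (ℙ.*-identityˡ (comp (g a) (hOf eQ))) (comp-at-X (g a))
    ; f≋ = λ i → ≋-trans (mul-cong X/X≋1 (comp-at-X (f a i))) (ℙ.*-identityˡ (f a i)) }
    where
    comp-at-X : ∀ u → comp u (hOf eQ) ≋ u
    comp-at-X u = ≋-trans (comp-cong (≋-refl {u}) hOf-eQ) (comp-X-right u)
    X/X≋1 : div X (hOf eQ) ≋ one
    X/X≋1 = ≋-trans (div-cong (≋-refl {X}) hOf-eQ (h-X+⋯ {eQ} e-closed))
                    (≋-sym (div-unique X+⋯-X (mul-identityˡ X)))

  ·-inverseʳ : ∀ {a} → Member a → (a ·Q invQ a) ≋Q eQ
  ·-inverseʳ {a} aQ = record
    { g≋ = begin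
        mul (g a) (comp (recip₁ G) h)   ≈⟨ ℙ.*-congˡ {g a} (comp-recip {h} h0 (trans (comp-at-0 (g a) h̄) (g-at-0 aQ))) ⟩
        mul (g a) (recip₁ (comp G h))   ≈⟨ ℙ.*-congˡ {g a} (recip-cong (comp-compInv-cancel hX (g a))
                                              (trans (comp-at-0 G h) (trans (comp-at-0 (g a) h̄) (g-at-0 aQ)))) ⟩
        mul (g a) (recip₁ (g a))        ≈⟨ recip-inverseʳ (g a) (g-at-0 aQ) ⟩
        one                             ∎
    ; f≋ = λ i → div-cross-mul {f a i} {h} {comp (f (invQ a) i) h} {X} (coeff₀ (f-X+⋯ aQ i)) hX (begin
        mul (f a i) (comp (div (mul X h̄) (comp (f a i) h̄)) h)
          ≈⟨ ℙ.*-congˡ {f a i} (comp-div {h} hX (mul-X-at-0 h̄) (comp-X+⋯ (f-X+⋯ aQ i) h̄X)) ⟩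
        mul (f a i) (div (comp (mul X h̄) h) (comp (comp (f a i) h̄) h))
          ≈⟨ ℙ.*-congˡ {f a i} (div-cong cXh̄h≋hX (comp-compInv-cancel hX (f a i))
                                          (comp-X+⋯ (comp-X+⋯ (f-X+⋯ aQ i) h̄X) hX)) ⟩
        mul (f a i) (div (mul h X) (f a i))
          ≈⟨ mul-comm (f a i) _ ⟩
        mul (div (mul h X) (f a i)) (f a i)
          ≈⟨ div-mul-cancel (trans (mul-at-0 h X) (trans (*-congʳ h0) (zeroˡ _))) (f-X+⋯ aQ i) ⟩
        mul h X
          ∎) }
    where
    open ≋-Reasoning
    h = hOf a
    hX = h-X+⋯ aQ
    h0 = coeff₀ hX
    h̄ = compInv h
    h̄X = X+⋯-compInv h
    G = comp (g a) h̄
    cXh̄h≋hX : comp (mul X h̄) h ≋ mul h X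
    cXh̄h≋hX = ≋-trans (comp-mul {h} h0 X h̄) (mul-cong (comp-X-left {h} h0) (compInv-comp hX))

  ·-inverseˡ : ∀ {a} → Member a → (invQ a ·Q a) ≋Q eQ
  ·-inverseˡ {a} aQ = record
    { g≋ = ≋-trans (ℙ.*-congˡ {recip₁ G} (comp-cong (≋-refl {g a}) hinv≋h̄))
                   (recip-inverseˡ G (trans (comp-at-0 (g a) h̄) (g-at-0 aQ)))
    ; f≋ = λ i → ≋-trans (mul-cong (div-cong (≋-refl {f (invQ a) i}) hinv≋h̄ (h-X+⋯ {invQ a} (inv-closed aQ)))
                                   (comp-cong (≋-refl {f a i}) hinv≋h̄))
                         (div-cross-mul {f (invQ a) i} {h̄} {comp (f a i) h̄} {X} (coeff₀ (f-X+⋯ {invQ a} (inv-closed aQ) i)) h̄X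
                           (≋-trans (div-mul-cancel {mul X h̄} {comp (f a i) h̄} (mul-X-at-0 h̄)
                                                    (comp-X+⋯ (f-X+⋯ aQ i) h̄X))
                                    (mul-comm X h̄))) }
    where
    h̄ = compInv (hOf a)
    h̄X = X+⋯-compInv (hOf a)
    G = comp (g a) h̄
    hinv≋h̄ : hOf (invQ a) ≋ h̄
    hinv≋h̄ = hOf-invQ {a} aQ

mainTheorem6 : ∀ {c ℓ} (R : CommutativeRing c ℓ) (inc : Containsℚ R) →
    let open QuadRiordan R inc in
    IsGroupOn InQ _≈Q_ _·Q_ eQ invQ
mainTheorem6 R inc = IsGroupOn-⇔ {P = Member} {InQ} {_≋Q_} {_≈Q_}
  Member⇒InQ InQ⇒Member ≋Q⇒≈Q ≈Q⇒≋Q (record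
  { ∙-closed  = ·-closed    ; e-closed    = e-closed    ; inv-closed = inv-closed
  ; ∙-cong    = ·-cong      ; inv-cong    = inv-cong    ; assoc      = ·-assoc
  ; identityˡ = ·-identityˡ ; identityʳ   = ·-identityʳ
  ; inverseˡ  = ·-inverseˡ  ; inverseʳ    = ·-inverseʳ })
  where
  open QuadRiordan R inc
  open QuadRiordanGroup R inc
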